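{- Let $R(z,C)$ be a rational function of $z$ and $C$ of the form $$R(z,C)=\frac{z\,N(z,C)}{\prod_{i=1}^m(1-zC^{a_i})},$$ where $N(z,C)$ is a polynomial in $z$ of degree less than $m$ whose coefficients are rational functions of $C$, and $a_1,\dots,a_m$ are distinct positive integers. Let $L=-\lim_{z\to\infty}R(z,C)$. Then $$\sum_{n=0}^{\infty}R(C^n,C)=Q(C)+L\,\Psi_1$$ for some rational function $Q(C)$ of $C$.
   Context: Let $c(x)=\sum_{n\ge0}\frac{1}{n+1}\binom{2n}{n}x^n=\frac{1-\sqrt{1-4x}}{2x}$ and $C=c(x)-1=xc(x)^2$, a formal power series in $x$ with zero constant term; rational functions of $C$ are regarded as formal Laurent series in $x$, and the infinite sums converge in the $x$-adic topology. Define $\Psi_1=\sum_{n=1}^{\infty}\frac{C^n}{1-C^n}$. -}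

module Defs where

open import Data.Nat as ℕ using (ℕ; zero; suc)
open import Data.Nat.Combinatorics using (_C_)
open import Data.Integer as ℤ using (ℤ; +_; -[1+_])
open import Data.Rational as ℚ using (ℚ; 0ℚ; 1ℚ)
open import Data.Fin using (Fin)
open import Data.List using (List; []; _∷_)
open import Data.List.Relation.Unary.Any using (Any)
open import Data.Product using (Σ; _×_)
open import Relation.Binary.PropositionalEquality using (_≡_; _≢_)
open import Relation.Nullary using (¬_)

PS : Set
PS = ℕ → ℚ

sumTo : ℕ → (ℕ → ℚ) → ℚ
sumTo zero    h = 0ℚ
sumTo (suc k) h = sumTo k h ℚ.+ h k

conv : PS → PS → PS
conv f g n = sumTo (suc n) (λ i → f i ℚ.* g (n ℕ.∸ i))

shiftPS : ℕ → PS → PS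
shiftPS zero    f n       = f n
shiftPS (suc j) f zero    = 0ℚ
shiftPS (suc j) f (suc n) = shiftPS j f n

-- Formal Laurent series:  (k , f)  represents  x^(-k) · f(x)

record Laurent : Set where
  constructor ⟨_,_⟩
  field
    ord : ℕ
    ser : PS
open Laurent public

atℤ : PS → ℤ → ℚ
atℤ f (+ n)    = f n
atℤ f -[1+ _ ] = 0ℚ

coeffL : Laurent → ℤ → ℚ
coeffL ⟨ k , f ⟩ e = atℤ f (e ℤ.+ + k)

infix 4 _≈_
_≈_ : Laurent → Laurent → Set
A ≈ B = ∀ e → coeffL A e ≡ coeffL B e

infixl 6 _+L_ _-L_
infixl 7 _*L_

_+L_ : Laurent → Laurent → Laurent
⟨ k , f ⟩ +L ⟨ l , g ⟩ = ⟨ k ℕ.+ l , (λ n → shiftPS l f n ℚ.+ shiftPS k g n) ⟩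

_*L_ : Laurent → Laurent → Laurent
⟨ k , f ⟩ *L ⟨ l , g ⟩ = ⟨ k ℕ.+ l , conv f g ⟩

negL : Laurent → Laurent
negL ⟨ k , f ⟩ = ⟨ k , (λ n → ℚ.- f n) ⟩

_-L_ : Laurent → Laurent → Laurent
A -L B = A +L negL B

constL : ℚ → Laurent
constL q = ⟨ 0 , (λ { zero → q ; (suc _) → 0ℚ }) ⟩

0L 1L : Laurent
0L = constL 0ℚ
1L = constL 1ℚ

powL : Laurent → ℕ → Laurent
powL A zero    = 1L
powL A (suc n) = A *L powL A n

-- C = c(x) - 1 = Σ_{n≥1} (1/(n+1)) binom(2n,n) x^n

catalan : ℕ → ℚ
catalan n = (+ ((2 ℕ.* n) C n)) ℚ./ suc n

Cser : PS
Cser zero    = 0ℚ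
Cser (suc n) = catalan (suc n)

C : Laurent
C = ⟨ 0 , Cser ⟩

evalC : List ℚ → Laurent
evalC []      = 0L
evalC (q ∷ p) = constL q +L C *L evalC p

NonzeroPoly : List ℚ → Set
NonzeroPoly = Any (λ q → q ≢ 0ℚ)

IsRatC : Laurent → Set
IsRatC Q = Σ (List ℚ) λ P → Σ (List ℚ) λ D → NonzeroPoly D × (Q *L evalC D ≈ evalC P)

ZPoly : Set
ZPoly = List Laurent

addZ : ZPoly → ZPoly → ZPoly
addZ []      q       = q
addZ p       []      = p
addZ (a ∷ p) (b ∷ q) = (a +L b) ∷ addZ p q

scaleZ : Laurent → ZPoly → ZPoly
scaleZ a []      = []
scaleZ a (b ∷ q) = (a *L b) ∷ scaleZ a q

mulZ : ZPoly → ZPoly → ZPoly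
mulZ []      q = []
mulZ (a ∷ p) q = addZ (scaleZ a q) (0L ∷ mulZ p q)

coeffZ : ZPoly → ℕ → Laurent
coeffZ []      j       = 0L
coeffZ (a ∷ p) zero    = a
coeffZ (a ∷ p) (suc j) = coeffZ p j

evalZ : ZPoly → Laurent → Laurent
evalZ []      z = 0L
evalZ (a ∷ p) z = a +L z *L evalZ p z

prodFin : (m : ℕ) → (Fin m → ZPoly) → ZPoly
prodFin zero    f = 1L ∷ []
prodFin (suc m) f = mulZ (f Fin.zero) (prodFin m (λ i → f (Fin.suc i)))
  where import Data.Fin as Fin

-- Finite limit as z → ∞ of the rational function p(z)/q(z):
-- deg p ≤ d = deg q, and the limit is (coeff_d p)/(coeff_d q).
IsLimAtInfinity : ZPoly → ZPoly → Laurent → Set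
IsLimAtInfinity p q L =
  Σ ℕ λ d → (∀ j → d ℕ.< j → coeffZ p j ≈ 0L)
          × (∀ j → d ℕ.< j → coeffZ q j ≈ 0L)
          × ¬ (coeffZ q d ≈ 0L)
          × (L *L coeffZ q d ≈ coeffZ p d)

partialSum : (ℕ → Laurent) → ℕ → Laurent
partialSum t zero    = 0L
partialSum t (suc N) = partialSum t N +L t N

-- S = Σ_{n ≥ 0} t n in the x-adic topology:
-- for every bound B, the partial sums eventually agree with S below x^B
IsSum : (ℕ → Laurent) → Laurent → Set
IsSum t S = ∀ (B : ℤ) → Σ ℕ λ M → ∀ N → M ℕ.≤ N →
              ∀ e → e ℤ.< B → coeffL (partialSum t N) e ≡ coeffL S e

module Submission where

-- Clearing the denominators of N and expanding into partial fractions over the polynomials in C gives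
-- ε R(z) = c₀ + ∑ cᵢ / (1 - z C^aᵢ) with ε ≠ 0 and all cᵢ polynomials in C. At z = 0 this says
-- c₀ + ∑ cᵢ = 0, and at z = ∞ it says c₀ = - ε L. As 1 / (1 - C^(n + aᵢ)) = 1 + ψ (n + aᵢ - 1), the terms
-- become ε R(Cⁿ) = ∑ cᵢ ψ (n + aᵢ - 1), so ε S = (∑ cᵢ) Ψ₁ - ∑ cᵢ (ψ 0 + ⋯ + ψ (aᵢ - 2)) = ε L Ψ₁ - F
-- where (1 - C)(1 - C²)⋯(1 - Cᴹ) F is a polynomial in C; thus S - L Ψ₁ is a rational function of C.
-- The sums converge x-adically because ψ n = O(xⁿ⁺¹) and R(Cⁿ) = O(xⁿ⁻ᴷ) for a fixed K.

open import Algebra.Bundles using (CommutativeRing)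
open import Level using (0ℓ)

-- The integers map into every commutative ring, which lets the library ring solver use integer coefficients.
module IntegerCoefficientSolver (R : CommutativeRing 0ℓ 0ℓ) where

  open CommutativeRing R
  open import Algebra.Properties.Semiring.Mult.TCOptimised semiring using (_×_; 1+×; ×-homo-+; ×1-homo-*)
  open import Algebra.Properties.Ring ring using (-‿involutive; -‿distribˡ-*; -‿distribʳ-*; -0#≈0#; -‿+-comm)
  open import Algebra.Properties.CommutativeSemigroup +-commutativeSemigroup using (interchange)
  open import Algebra.Solver.Ring.AlmostCommutativeRing
    using (fromCommutativeRing; _-Raw-AlmostCommutative⟶_)
  import Algebra.Solver.Ring as Solver
  open import Data.Maybe using (Maybe; nothing; just)
  open import Data.Nat as ℕ using (ℕ; zero; suc)
  open import Data.Integer as ℤ using (ℤ; +_; -[1+_])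
  import Data.Integer.Properties as ℤ
  import Data.Nat.Properties as ℕ
  open import Data.Sign as Sign using (Sign)
  open import Relation.Nullary using (yes; no)
  import Relation.Binary.PropositionalEquality as ≡
  open import Relation.Binary.Reasoning.Setoid setoid

  ⟦_⟧ : ℤ → Carrier
  ⟦ + n ⟧      = n × 1#
  ⟦ -[1+ n ] ⟧ = - (suc n × 1#)

  signed : Sign → Carrier → Carrier
  signed Sign.+ x = x
  signed Sign.- x = - x

  ⟦⟧-signed : ∀ s n → ⟦ s ℤ.◃ n ⟧ ≈ signed s (n × 1#)
  ⟦⟧-signed Sign.+ zero    = refl
  ⟦⟧-signed Sign.+ (suc n) = refl
  ⟦⟧-signed Sign.- zero    = sym -0#≈0#
  ⟦⟧-signed Sign.- (suc n) = refl

  signed-* : ∀ s t x y → signed (s Sign.* t) (x * y) ≈ signed s x * signed t y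
  signed-* Sign.+ Sign.+ x y = refl
  signed-* Sign.+ Sign.- x y = -‿distribʳ-* x y
  signed-* Sign.- Sign.+ x y = -‿distribˡ-* x y
  signed-* Sign.- Sign.- x y = begin
    x * y       ≈⟨ *-congʳ (sym (-‿involutive x)) ⟩
    - - x * y   ≈⟨ sym (-‿distribˡ-* (- x) y) ⟩
    - (- x * y) ≈⟨ -‿distribʳ-* (- x) y ⟩
    - x * - y   ∎

  ⟦⟧-⊖ : ∀ m n → ⟦ m ℤ.⊖ n ⟧ ≈ m × 1# - n × 1#
  ⟦⟧-⊖ m       zero    = sym (trans (+-congˡ -0#≈0#) (+-identityʳ _))
  ⟦⟧-⊖ zero    (suc n) = sym (+-identityˡ _)
  ⟦⟧-⊖ (suc m) (suc n) = begin
    ⟦ suc m ℤ.⊖ suc n ⟧            ≡⟨ ≡.cong ⟦_⟧ (ℤ.[1+m]⊖[1+n]≡m⊖n m n) ⟩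
    ⟦ m ℤ.⊖ n ⟧                    ≈⟨ ⟦⟧-⊖ m n ⟩
    x - y                          ≈⟨ sym (+-identityˡ (x - y)) ⟩
    0# + (x - y)                   ≈⟨ +-congʳ (sym (-‿inverseʳ 1#)) ⟩
    (1# - 1#) + (x - y)            ≈⟨ interchange 1# (- 1#) x (- y) ⟩
    (1# + x) + (- 1# - y)          ≈⟨ +-congˡ (-‿+-comm 1# y) ⟩
    (1# + x) - (1# + y)            ≈⟨ +-cong (sym (1+× m 1#)) (-‿cong (sym (1+× n 1#))) ⟩
    suc m × 1# - suc n × 1#        ∎
    where
    x = m × 1#
    y = n × 1#

  ⟦⟧-+ : ∀ i j → ⟦ i ℤ.+ j ⟧ ≈ ⟦ i ⟧ + ⟦ j ⟧
  ⟦⟧-+ -[1+ m ] -[1+ n ] = begin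
    - (suc (suc (m ℕ.+ n)) × 1#)    ≡⟨ ≡.cong (λ k → - (suc k × 1#)) (≡.sym (ℕ.+-suc m n)) ⟩
    - ((suc m ℕ.+ suc n) × 1#)      ≈⟨ -‿cong (×-homo-+ 1# (suc m) (suc n)) ⟩
    - (suc m × 1# + suc n × 1#)     ≈⟨ sym (-‿+-comm _ _) ⟩
    - (suc m × 1#) - (suc n × 1#)   ∎
  ⟦⟧-+ -[1+ m ] (+ n) = trans (⟦⟧-⊖ n (suc m)) (+-comm _ _)
  ⟦⟧-+ (+ m) -[1+ n ] = ⟦⟧-⊖ m (suc n)
  ⟦⟧-+ (+ m) (+ n)    = ×-homo-+ 1# m n

  ⟦⟧-* : ∀ i j → ⟦ i ℤ.* j ⟧ ≈ ⟦ i ⟧ * ⟦ j ⟧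
  ⟦⟧-* i j = begin
    ⟦ s ℤ.◃ ℤ.∣ i ∣ ℕ.* ℤ.∣ j ∣ ⟧
      ≈⟨ ⟦⟧-signed s (ℤ.∣ i ∣ ℕ.* ℤ.∣ j ∣) ⟩
    signed s ((ℤ.∣ i ∣ ℕ.* ℤ.∣ j ∣) × 1#)
      ≈⟨ signed-cong s (×1-homo-* ℤ.∣ i ∣ ℤ.∣ j ∣) ⟩
    signed s (ℤ.∣ i ∣ × 1# * ℤ.∣ j ∣ × 1#)
      ≈⟨ signed-* (ℤ.sign i) (ℤ.sign j) _ _ ⟩
    signed (ℤ.sign i) (ℤ.∣ i ∣ × 1#) * signed (ℤ.sign j) (ℤ.∣ j ∣ × 1#)
      ≈⟨ *-cong (sym (signed-sign i)) (sym (signed-sign j)) ⟩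
    ⟦ i ⟧ * ⟦ j ⟧ ∎
    where
    s = ℤ.sign i Sign.* ℤ.sign j
    signed-cong : ∀ s {x y} → x ≈ y → signed s x ≈ signed s y
    signed-cong Sign.+ p = p
    signed-cong Sign.- p = -‿cong p
    signed-sign : ∀ i → ⟦ i ⟧ ≈ signed (ℤ.sign i) (ℤ.∣ i ∣ × 1#)
    signed-sign (+ n)    = refl
    signed-sign -[1+ n ] = refl

  ⟦⟧-neg : ∀ i → ⟦ ℤ.- i ⟧ ≈ - ⟦ i ⟧
  ⟦⟧-neg (+ zero)  = sym -0#≈0#
  ⟦⟧-neg (+ suc n) = refl
  ⟦⟧-neg -[1+ n ]  = sym (-‿involutive _)

  ℤ⟶R : CommutativeRing.rawRing ℤ.+-*-commutativeRing -Raw-AlmostCommutative⟶ fromCommutativeRing R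
  ℤ⟶R = record
    { ⟦_⟧ = ⟦_⟧ ; +-homo = ⟦⟧-+ ; *-homo = ⟦⟧-* ; -‿homo = ⟦⟧-neg
    ; 0-homo = refl ; 1-homo = refl }

  ⟦⟧-≟ : ∀ i j → Maybe (⟦ i ⟧ ≈ ⟦ j ⟧)
  ⟦⟧-≟ i j with i ℤ.≟ j
  ... | yes i≡j = just (reflexive (≡.cong ⟦_⟧ i≡j))
  ... | no _    = nothing

  open Solver _ _ ℤ⟶R ⟦⟧-≟ public using (Polynomial; solve; _:=_; _:+_; _:*_; _:-_; :-_; con)

module PartialFractions (R : CommutativeRing 0ℓ 0ℓ) where

  open CommutativeRing R hiding (zero)
  open import Algebra.Properties.Semiring.Exp semiring using (_^_)
  open import Algebra.Properties.Semiring.Sum semiring using (sum; sum-cong-≋; *-distribʳ-sum)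
  open import Algebra.Properties.CommutativeMonoid.Sum *-commutativeMonoid using () renaming (sum to product)
  open import Data.Nat using (zero; suc)
  open import Data.Fin using (Fin; zero; suc)
  open import Data.Fin.Properties using (suc-injective)
  open import Data.Vec using (Vec; []; _∷_; map; last; _∷ʳ_)
  open import Data.Vec.Properties using (last-∷ʳ)
  open import Data.Vec.Relation.Unary.All using (All; []; _∷_)
  open import Data.Integer using (+_)
  open import Function using (_∘_)
  open import Relation.Unary using (Pred)
  import Relation.Binary.PropositionalEquality as ≡
  open import Relation.Binary.PropositionalEquality using (_≢_)
  open import Relation.Binary.Reasoning.Setoid setoid
  open IntegerCoefficientSolver R

  private
    :1 :0 : ∀ {n} → Polynomial n
    :1 = con (+ 1)
    :0 = con (+ 0)

  eval : ∀ {n} → Vec Carrier n → Carrier → Carrier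
  eval []      z = 0#
  eval (p ∷ v) z = p + z * eval v z

  eval-scale : ∀ {n} a (v : Vec Carrier n) z → eval (map (a *_) v) z ≈ a * eval v z
  eval-scale a []      z = sym (zeroʳ a)
  eval-scale a (p ∷ v) z = begin
    a * p + z * eval (map (a *_) v) z ≈⟨ +-congˡ (*-congˡ (eval-scale a v z)) ⟩
    a * p + z * (a * eval v z)        ≈⟨ solve 4 (λ a p z e → a :* p :+ z :* (a :* e) := a :* (p :+ z :* e)) refl a p z (eval v z) ⟩
    a * (p + z * eval v z)            ∎

  eval-pad : ∀ {n} (v : Vec Carrier n) z → eval (v ∷ʳ 0#) z ≈ eval v z
  eval-pad []      z = solve 1 (λ z → :0 :+ z :* :0 := :0) refl z
  eval-pad (p ∷ v) z = +-congˡ (*-congˡ (eval-pad v z))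

  last-scale : ∀ {n} a (v : Vec Carrier (suc n)) → last (map (a *_) v) ≡.≡ a * last v
  last-scale a (p ∷ [])     = ≡.refl
  last-scale a (p ∷ q ∷ v) = last-scale a (q ∷ v)

  -- Division of a polynomial v of degree ≤ n by 1 - z a, made division-free by scaling v by a ^ n:
  -- the remainder is the reversed polynomial of v evaluated at a.
  remainder : ∀ {n} → Carrier → Vec Carrier n → Carrier
  remainder a []              = 0#
  remainder a (_∷_ {n} p v) = a ^ n * p + remainder a v

  quotient : ∀ {n} → Carrier → Vec Carrier (suc n) → Vec Carrier n
  quotient a (p ∷ [])     = []
  quotient a (p ∷ q ∷ v) = - remainder a (q ∷ v) ∷ map (a *_) (quotient a (q ∷ v))

  division : ∀ {n} a (v : Vec Carrier (suc n)) z →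
             a ^ n * eval v z ≈ (1# - z * a) * eval (quotient a v) z + remainder a v
  division a (p ∷ []) z = solve 3 (λ p z a → :1 :* (p :+ z :* :0) := (:1 :- z :* a) :* :0 :+ (:1 :* p :+ :0)) refl p z a
  division {suc n} a (p ∷ q ∷ v) z = begin
    a * a ^ n * (p + z * eval (q ∷ v) z)
      ≈⟨ solve 5 (λ a an p z e → (a :* an) :* (p :+ z :* e) := (a :* an) :* p :+ z :* a :* (an :* e)) refl a (a ^ n) p z (eval (q ∷ v) z) ⟩
    a * a ^ n * p + z * a * (a ^ n * eval (q ∷ v) z)
      ≈⟨ +-congˡ (*-congˡ (division a (q ∷ v) z)) ⟩
    a * a ^ n * p + z * a * ((1# - z * a) * y + r)
      ≈⟨ solve 6 (λ a an p z y r → a :* an :* p :+ z :* a :* ((:1 :- z :* a) :* y :+ r)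
                  := (:1 :- z :* a) :* (:- r :+ z :* (a :* y)) :+ (a :* an :* p :+ r)) refl a (a ^ n) p z y r ⟩
    (1# - z * a) * (- r + z * (a * y)) + (a * a ^ n * p + r)
      ≈⟨ +-congʳ (*-congˡ (+-congˡ (*-congˡ (sym (eval-scale a (quotient a (q ∷ v)) z))))) ⟩
    (1# - z * a) * (- r + z * eval (map (a *_) (quotient a (q ∷ v))) z) + (a * a ^ n * p + r) ∎
    where
    y = eval (quotient a (q ∷ v)) z
    r = remainder a (q ∷ v)

  last-quotient : ∀ {n} a (v : Vec Carrier (suc (suc n))) → a ^ suc n * last v ≈ - a * last (quotient a v)
  last-quotient a (p ∷ q ∷ []) = solve 2 (λ a q → a :* :1 :* q := :- a :* (:- (:1 :* q :+ :0))) refl a q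
  last-quotient {suc n} a (p ∷ q ∷ w ∷ v) = begin
    a * a ^ suc n * last (w ∷ v)               ≈⟨ *-assoc a (a ^ suc n) (last (w ∷ v)) ⟩
    a * (a ^ suc n * last (w ∷ v))             ≈⟨ *-congˡ (last-quotient a (q ∷ w ∷ v)) ⟩
    a * (- a * l)                              ≈⟨ solve 2 (λ a l → a :* (:- a :* l) := :- a :* (a :* l)) refl a l ⟩
    - a * (a * l)                              ≈⟨ *-congˡ (reflexive (≡.sym (last-scale a (quotient a (q ∷ w ∷ v))))) ⟩
    - a * last (map (a *_) (quotient a (q ∷ w ∷ v))) ∎
    where l = last (quotient a (q ∷ w ∷ v))

  mulLinear : ∀ {n} → Carrier → Vec Carrier n → Vec Carrier (suc n)
  mulLinear b []      = 0# ∷ []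
  mulLinear b (p ∷ v) with mulLinear b v
  ... | q ∷ w = p ∷ (q - b * p) ∷ w

  eval-mulLinear : ∀ {n} b (v : Vec Carrier n) z → eval (mulLinear b v) z ≈ (1# - z * b) * eval v z
  eval-mulLinear b []      z = solve 2 (λ b z → :0 :+ z :* :0 := (:1 :- z :* b) :* :0) refl b z
  eval-mulLinear b (p ∷ v) z with mulLinear b v | eval-mulLinear b v z
  ... | q ∷ w | ih = begin
    p + z * ((q - b * p) + z * eval w z)   ≈⟨ solve 5 (λ b p q z w → p :+ z :* ((q :- b :* p) :+ z :* w)
                                                       := p :- z :* b :* p :+ z :* (q :+ z :* w)) refl b p q z (eval w z) ⟩
    p - z * b * p + z * (q + z * eval w z) ≈⟨ +-congˡ (*-congˡ ih) ⟩
    p - z * b * p + z * ((1# - z * b) * e) ≈⟨ solve 4 (λ b p z e → p :- z :* b :* p :+ z :* ((:1 :- z :* b) :* e) := (:1 :- z :* b) :* (p :+ z :* e)) refl b p z e ⟩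
    (1# - z * b) * (p + z * e)             ∎
    where e = eval v z

  remainder-mulLinear : ∀ {n} a b (v : Vec Carrier n) → remainder a (mulLinear b v) ≈ (a - b) * remainder a v
  remainder-mulLinear a b []      = solve 2 (λ a b → :1 :* :0 :+ :0 := (a :- b) :* :0) refl a b
  remainder-mulLinear {suc n} a b (p ∷ v) with mulLinear b v | remainder-mulLinear a b v
  ... | q ∷ w | ih = begin
    a * a ^ n * p + (a ^ n * (q - b * p) + remainder a w)
      ≈⟨ solve 6 (λ a b an p q r → a :* an :* p :+ (an :* (q :- b :* p) :+ r) := (a :- b) :* (an :* p) :+ (an :* q :+ r))
                 refl a b (a ^ n) p q (remainder a w) ⟩
    (a - b) * (a ^ n * p) + (a ^ n * q + remainder a w)
      ≈⟨ +-congˡ ih ⟩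
    (a - b) * (a ^ n * p) + (a - b) * remainder a v
      ≈⟨ sym (distribˡ (a - b) _ _) ⟩
    (a - b) * (a ^ n * p + remainder a v) ∎

  denominator : ∀ {m} → (Fin m → Carrier) → Carrier → Carrier
  denominator A z = product (λ i → 1# - z * A i)

  cofactor : ∀ {m} → (Fin m → Carrier) → Fin m → Carrier → Carrier
  cofactor A zero    z = denominator (A ∘ suc) z
  cofactor A (suc i) z = (1# - z * A zero) * cofactor (A ∘ suc) i z

  denominator*inverses : ∀ {m} (A : Fin m → Carrier) z (g : Fin m → Carrier) →
                         (∀ i → g i * (1# - z * A i) ≈ 1#) → denominator A z * product g ≈ 1#
  denominator*inverses {zero}  A z g g-inv = *-identityˡ 1#
  denominator*inverses {suc m} A z g g-inv = begin
    (E * denominator (A ∘ suc) z) * (g zero * product (g ∘ suc))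
      ≈⟨ solve 4 (λ e d x y → (e :* d) :* (x :* y) := (x :* e) :* (d :* y)) refl E (denominator (A ∘ suc) z) (g zero) (product (g ∘ suc)) ⟩
    (g zero * E) * (denominator (A ∘ suc) z * product (g ∘ suc))
      ≈⟨ *-cong (g-inv zero) (denominator*inverses (A ∘ suc) z (g ∘ suc) (g-inv ∘ suc)) ⟩
    1# * 1#
      ≈⟨ *-identityˡ 1# ⟩
    1# ∎
    where E = 1# - z * A zero

  cofactor*inverses : ∀ {m} (A : Fin m → Carrier) z (g : Fin m → Carrier) →
                      (∀ i → g i * (1# - z * A i) ≈ 1#) → ∀ i → cofactor A i z * product g ≈ g i
  cofactor*inverses A z g g-inv zero = begin
    D′ * (g zero * product (g ∘ suc))  ≈⟨ solve 3 (λ d x y → d :* (x :* y) := x :* (d :* y)) refl D′ (g zero) (product (g ∘ suc)) ⟩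
    g zero * (D′ * product (g ∘ suc))  ≈⟨ *-congˡ (denominator*inverses (A ∘ suc) z (g ∘ suc) (g-inv ∘ suc)) ⟩
    g zero * 1#                        ≈⟨ *-identityʳ (g zero) ⟩
    g zero                             ∎
    where D′ = denominator (A ∘ suc) z
  cofactor*inverses A z g g-inv (suc i) = begin
    (E * cofactor (A ∘ suc) i z) * (g zero * product (g ∘ suc))
      ≈⟨ solve 4 (λ e d x y → (e :* d) :* (x :* y) := (x :* e) :* (d :* y)) refl E (cofactor (A ∘ suc) i z) (g zero) (product (g ∘ suc)) ⟩
    (g zero * E) * (cofactor (A ∘ suc) i z * product (g ∘ suc))
      ≈⟨ *-cong (g-inv zero) (cofactor*inverses (A ∘ suc) z (g ∘ suc) (g-inv ∘ suc) i) ⟩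
    1# * g (suc i)
      ≈⟨ *-identityˡ (g (suc i)) ⟩
    g (suc i) ∎
    where E = 1# - z * A zero

  denominator-0 : ∀ {m} (A : Fin m → Carrier) → denominator A 0# ≈ 1#
  denominator-0 {zero}  A = refl
  denominator-0 {suc m} A =
    trans (*-cong (solve 1 (λ a → :1 :- :0 :* a := :1) refl (A zero)) (denominator-0 (A ∘ suc))) (*-identityˡ 1#)

  cofactor-0 : ∀ {m} (A : Fin m → Carrier) i → cofactor A i 0# ≈ 1#
  cofactor-0 A zero    = denominator-0 (A ∘ suc)
  cofactor-0 A (suc i) =
    trans (*-cong (solve 1 (λ a → :1 :- :0 :* a := :1) refl (A zero)) (cofactor-0 (A ∘ suc) i)) (*-identityˡ 1#)

  denominatorCoeffs : ∀ {m} → (Fin m → Carrier) → Vec Carrier (suc m)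
  denominatorCoeffs {zero}  A = 1# ∷ []
  denominatorCoeffs {suc m} A = mulLinear (A zero) (denominatorCoeffs (A ∘ suc))

  eval-denominatorCoeffs : ∀ {m} (A : Fin m → Carrier) z → eval (denominatorCoeffs A) z ≈ denominator A z
  eval-denominatorCoeffs {zero}  A z = solve 1 (λ z → :1 :+ z :* :0 := :1) refl z
  eval-denominatorCoeffs {suc m} A z =
    trans (eval-mulLinear (A zero) (denominatorCoeffs (A ∘ suc)) z) (*-congˡ (eval-denominatorCoeffs (A ∘ suc) z))

  remainder-denominatorCoeffs : ∀ {m} (A : Fin m → Carrier) a →
                                remainder a (denominatorCoeffs A) ≈ product (λ i → a - A i)
  remainder-denominatorCoeffs {zero}  A a = solve 1 (λ a → :1 :* :1 :+ :0 := :1) refl a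
  remainder-denominatorCoeffs {suc m} A a =
    trans (remainder-mulLinear a (A zero) (denominatorCoeffs (A ∘ suc))) (*-congˡ (remainder-denominatorCoeffs (A ∘ suc) a))

  sum-linearCombination : ∀ {m} α β E (c d x : Fin m → Carrier) →
    sum (λ i → (α * c i - β * d i) * (E * x i)) ≈ α * E * sum (λ i → c i * x i) - β * E * sum (λ i → d i * x i)
  sum-linearCombination {zero}  α β E c d x = solve 3 (λ α β E → :0 := α :* E :* :0 :- β :* E :* :0) refl α β E
  sum-linearCombination {suc m} α β E c d x = begin
    (α * c zero - β * d zero) * (E * x zero) + sum (λ i → (α * c (suc i) - β * d (suc i)) * (E * x (suc i)))
      ≈⟨ +-congˡ (sum-linearCombination α β E (c ∘ suc) (d ∘ suc) (x ∘ suc)) ⟩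
    (α * c zero - β * d zero) * (E * x zero) + (α * E * s - β * E * t)
      ≈⟨ solve 8 (λ α β E c d x s t → (α :* c :- β :* d) :* (E :* x) :+ (α :* E :* s :- β :* E :* t)
                  := α :* E :* (c :* x :+ s) :- β :* E :* (d :* x :+ t)) refl α β E (c zero) (d zero) (x zero) s t ⟩
    α * E * (c zero * x zero + s) - β * E * (d zero * x zero + t) ∎
    where
    s = sum (λ i → c (suc i) * x (suc i))
    t = sum (λ i → d (suc i) * x (suc i))

  sum-*-add : ∀ {m} (c y : Fin m → Carrier) x → sum (λ i → c i * (x + y i)) ≈ sum c * x + sum (λ i → c i * y i)
  sum-*-add {zero}  c y x = solve 1 (λ x → :0 := :0 :* x :+ :0) refl x
  sum-*-add {suc m} c y x = begin
    c zero * (x + y zero) + sum (λ i → c (suc i) * (x + y (suc i)))  ≈⟨ +-congˡ (sum-*-add (c ∘ suc) (y ∘ suc) x) ⟩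
    c zero * (x + y zero) + (s * x + t)                              ≈⟨ solve 5 (λ c x y s t → c :* (x :+ y) :+ (s :* x :+ t)
                                                                                 := (c :+ s) :* x :+ (c :* y :+ t)) refl (c zero) x (y zero) s t ⟩
    (c zero + s) * x + (c zero * y zero + t)                         ∎
    where
    s = sum (c ∘ suc)
    t = sum (λ i → c (suc i) * y (suc i))

  sum-*-sub : ∀ {m} (c y : Fin m → Carrier) x → sum (λ i → c i * (x - y i)) ≈ sum c * x - sum (λ i → c i * y i)
  sum-*-sub {zero}  c y x = solve 1 (λ x → :0 := :0 :* x :- :0) refl x
  sum-*-sub {suc m} c y x = begin
    c zero * (x - y zero) + sum (λ i → c (suc i) * (x - y (suc i)))  ≈⟨ +-congˡ (sum-*-sub (c ∘ suc) (y ∘ suc) x) ⟩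
    c zero * (x - y zero) + (s * x - t)                              ≈⟨ solve 5 (λ c x y s t → c :* (x :- y) :+ (s :* x :- t)
                                                                                 := (c :+ s) :* x :- (c :* y :+ t)) refl (c zero) x (y zero) s t ⟩
    (c zero + s) * x - (c zero * y zero + t)                         ∎
    where
    s = sum (c ∘ suc)
    t = sum (λ i → c (suc i) * y (suc i))

  -- Partial fractions with coefficients in a subring S, after clearing a denominator δ taken from a
  -- multiplicative set M:  δ P(z) / ∏ (1 - z Aᵢ) = c₀ + ∑ cᵢ / (1 - z Aᵢ).
  module Decomposition
    (S : Pred Carrier 0ℓ) (S-0 : S 0#) (S-1 : S 1#)
    (S-+ : ∀ {x y} → S x → S y → S (x + y)) (S-* : ∀ {x y} → S x → S y → S (x * y)) (S-neg : ∀ {x} → S x → S (- x))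
    (M : Pred Carrier 0ℓ) (M-1 : M 1#) (M-* : ∀ {x y} → M x → M y → M (x * y)) (M-resp : ∀ {x y} → x ≈ y → M x → M y)
    where

    S-^ : ∀ {a} n → S a → S (a ^ n)
    S-^ zero    a∈S = S-1
    S-^ (suc n) a∈S = S-* a∈S (S-^ n a∈S)

    M-^ : ∀ {a} n → M a → M (a ^ n)
    M-^ zero    a∈M = M-1
    M-^ (suc n) a∈M = M-* a∈M (M-^ n a∈M)

    M-product : ∀ {m} (f : Fin m → Carrier) → (∀ i → M (f i)) → M (product f)
    M-product {zero}  f f∈M = M-1
    M-product {suc m} f f∈M = M-* (f∈M zero) (M-product (f ∘ suc) (f∈M ∘ suc))

    S-remainder : ∀ {n a} (v : Vec Carrier n) → S a → All S v → S (remainder a v)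
    S-remainder []              a∈S []          = S-0
    S-remainder {suc n} (p ∷ v) a∈S (p∈S ∷ v∈S) = S-+ (S-* (S-^ n a∈S) p∈S) (S-remainder v a∈S v∈S)

    S-scale : ∀ {n a} (v : Vec Carrier n) → S a → All S v → All S (map (a *_) v)
    S-scale []      a∈S []          = []
    S-scale (p ∷ v) a∈S (p∈S ∷ v∈S) = S-* a∈S p∈S ∷ S-scale v a∈S v∈S

    S-quotient : ∀ {n a} (v : Vec Carrier (suc n)) → S a → All S v → All S (quotient a v)
    S-quotient (p ∷ [])     a∈S v∈S         = []
    S-quotient (p ∷ q ∷ v) a∈S (_ ∷ v∈S) =
      S-neg (S-remainder (q ∷ v) a∈S v∈S) ∷ S-scale (quotient _ (q ∷ v)) a∈S (S-quotient (q ∷ v) a∈S v∈S)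

    S-mulLinear : ∀ {n b} (v : Vec Carrier n) → S b → All S v → All S (mulLinear b v)
    S-mulLinear []      b∈S []          = S-0 ∷ []
    S-mulLinear {b = b} (p ∷ v) b∈S (p∈S ∷ v∈S) with mulLinear b v | S-mulLinear v b∈S v∈S
    ... | q ∷ w | q∈S ∷ w∈S = p∈S ∷ S-+ q∈S (S-neg (S-* b∈S p∈S)) ∷ w∈S

    S-denominatorCoeffs : ∀ {m} (A : Fin m → Carrier) → (∀ i → S (A i)) → All S (denominatorCoeffs A)
    S-denominatorCoeffs {zero}  A A∈S = S-1 ∷ []
    S-denominatorCoeffs {suc m} A A∈S = S-mulLinear _ (A∈S zero) (S-denominatorCoeffs (A ∘ suc) (A∈S ∘ suc))

    S-pad : ∀ {n} (v : Vec Carrier n) → All S v → All S (v ∷ʳ 0#)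
    S-pad []      []          = S-0 ∷ []
    S-pad (p ∷ v) (p∈S ∷ v∈S) = p∈S ∷ S-pad v v∈S

    record Separated {m} (A : Fin m → Carrier) : Set where
      field
        A∈S   : ∀ i → S (A i)
        A∈M   : ∀ i → M (A i)
        A-A∈M : ∀ {i j} → i ≢ j → M (A i - A j)

    record PartialFractionExpansion {m} (A : Fin m → Carrier) (P : Vec Carrier (suc m)) : Set where
      field
        δ c₀     : Carrier
        c        : Fin m → Carrier
        δ∈M      : M δ
        δ∈S      : S δ
        c₀∈S     : S c₀
        c∈S      : ∀ i → S (c i)
        identity : ∀ z → δ * eval P z ≈ c₀ * denominator A z + sum (λ i → c i * cofactor A i z)
        leading  : c₀ * product (λ i → - A i) ≈ δ * last P

    -- Divide P and the denominator D' of the remaining factors by 1 - z a: a^(m+1) P = (1 - z a) Q + r and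
    -- a^m D' = (1 - z a) B + Δ; expanding Q and B by recursion leaves only the constant r, which
    -- Δ = a^m D' - (1 - z a) B writes as a multiple of the new cofactor D'.
    module ExpansionStep {m} (A : Fin (suc m) → Carrier) (P : Vec Carrier (suc (suc m)))
      (R₁ : PartialFractionExpansion (A ∘ suc) (quotient (A zero) P))
      (R₂ : PartialFractionExpansion (A ∘ suc) (quotient (A zero) (denominatorCoeffs (A ∘ suc)) ∷ʳ 0#)) where

      a : Carrier
      a = A zero

      A′ : Fin m → Carrier
      A′ = A ∘ suc

      B : Vec Carrier m
      B = quotient a (denominatorCoeffs A′)

      open PartialFractionExpansion R₁ using () renaming (δ to δ₁; c₀ to c₀₁; c to c₁)
      open PartialFractionExpansion R₂ using () renaming (δ to δ₂; c₀ to c₀₂; c to c₂)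

      r Δ : Carrier
      r = remainder a P
      Δ = remainder a (denominatorCoeffs A′)

      δ c₀ : Carrier
      δ  = δ₁ * δ₂ * Δ * a ^ suc m
      c₀ = δ₂ * Δ * c₀₁ - δ₁ * r * c₀₂

      c : Fin (suc m) → Carrier
      c zero    = δ₁ * r * δ₂ * a ^ m
      c (suc i) = δ₂ * Δ * c₁ i - δ₁ * r * c₂ i

      identity : ∀ z → δ * eval P z ≈ c₀ * denominator A z + sum (λ i → c i * cofactor A i z)
      identity z = begin
        δ₁ * δ₂ * Δ * a ^ suc m * eval P z
          ≈⟨ solve 5 (λ d₁ d₂ Δ x p → d₁ :* d₂ :* Δ :* x :* p := d₂ :* Δ :* d₁ :* (x :* p)) refl δ₁ δ₂ Δ (a ^ suc m) (eval P z) ⟩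
        δ₂ * Δ * δ₁ * (a ^ suc m * eval P z)
          ≈⟨ *-congˡ (division a P z) ⟩
        δ₂ * Δ * δ₁ * (E * eval Q z + r)
          ≈⟨ solve 6 (λ d₁ d₂ Δ E q r → d₂ :* Δ :* d₁ :* (E :* q :+ r) := d₂ :* Δ :* E :* (d₁ :* q) :+ d₁ :* r :* (d₂ :* Δ)) refl δ₁ δ₂ Δ E (eval Q z) r ⟩
        δ₂ * Δ * E * (δ₁ * eval Q z) + δ₁ * r * (δ₂ * Δ)
          ≈⟨ +-cong (*-congˡ (PartialFractionExpansion.identity R₁ z)) (*-congˡ δ₂Δ) ⟩
        δ₂ * Δ * E * (c₀₁ * D′ + S₁) + δ₁ * r * (δ₂ * a ^ m * D′ - E * (c₀₂ * D′ + S₂))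
          ≈⟨ solve 11 (λ d₁ d₂ Δ E c₀₁ c₀₂ D′ S₁ S₂ r x →
                d₂ :* Δ :* E :* (c₀₁ :* D′ :+ S₁) :+ d₁ :* r :* (d₂ :* x :* D′ :- E :* (c₀₂ :* D′ :+ S₂))
                := (d₂ :* Δ :* c₀₁ :- d₁ :* r :* c₀₂) :* (E :* D′) :+ (d₁ :* r :* d₂ :* x :* D′ :+ (d₂ :* Δ :* E :* S₁ :- d₁ :* r :* E :* S₂)))
              refl δ₁ δ₂ Δ E c₀₁ c₀₂ D′ S₁ S₂ r (a ^ m) ⟩
        c₀ * (E * D′) + (c zero * D′ + (δ₂ * Δ * E * S₁ - δ₁ * r * E * S₂))
          ≈⟨ +-congˡ (+-congˡ (sym (sum-linearCombination (δ₂ * Δ) (δ₁ * r) E c₁ c₂ (λ i → cofactor A′ i z)))) ⟩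
        c₀ * (E * D′) + (c zero * D′ + sum (λ i → c (suc i) * (E * cofactor A′ i z))) ∎
        where
        E  = 1# - z * a
        Q  = quotient a P
        D′ = denominator A′ z
        S₁ = sum (λ i → c₁ i * cofactor A′ i z)
        S₂ = sum (λ i → c₂ i * cofactor A′ i z)
        eval-B : δ₂ * eval B z ≈ c₀₂ * D′ + S₂
        eval-B = trans (*-congˡ (sym (eval-pad B z))) (PartialFractionExpansion.identity R₂ z)
        division-D′ : a ^ m * D′ ≈ E * eval B z + Δ
        division-D′ = trans (*-congˡ (sym (eval-denominatorCoeffs A′ z))) (division a (denominatorCoeffs A′) z)
        δ₂Δ : δ₂ * Δ ≈ δ₂ * a ^ m * D′ - E * (c₀₂ * D′ + S₂)
        δ₂Δ = begin
          δ₂ * Δ                                    ≈⟨ solve 3 (λ d Δ y → d :* Δ := d :* ((y :+ Δ) :- y)) refl δ₂ Δ (E * eval B z) ⟩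
          δ₂ * ((E * eval B z + Δ) - E * eval B z)  ≈⟨ *-congˡ (+-congʳ (sym division-D′)) ⟩
          δ₂ * (a ^ m * D′ - E * eval B z)          ≈⟨ solve 5 (λ d x D′ E b → d :* (x :* D′ :- E :* b)
                                                                := d :* x :* D′ :- E :* (d :* b)) refl δ₂ (a ^ m) D′ E (eval B z) ⟩
          δ₂ * a ^ m * D′ - E * (δ₂ * eval B z)     ≈⟨ +-congˡ (-‿cong (*-congˡ eval-B)) ⟩
          δ₂ * a ^ m * D′ - E * (c₀₂ * D′ + S₂)     ∎

      leading : c₀ * product (λ i → - A i) ≈ δ * last P
      leading = begin
        (δ₂ * Δ * c₀₁ - δ₁ * r * c₀₂) * (- a * ℓ)
          ≈⟨ solve 8 (λ d₁ d₂ Δ c₀₁ c₀₂ na ℓ r → (d₂ :* Δ :* c₀₁ :- d₁ :* r :* c₀₂) :* (na :* ℓ)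
                      := na :* d₂ :* Δ :* (c₀₁ :* ℓ) :- na :* d₁ :* r :* (c₀₂ :* ℓ)) refl δ₁ δ₂ Δ c₀₁ c₀₂ (- a) ℓ r ⟩
        - a * δ₂ * Δ * (c₀₁ * ℓ) - - a * δ₁ * r * (c₀₂ * ℓ)
          ≈⟨ +-cong (*-congˡ (PartialFractionExpansion.leading R₁)) (-‿cong (*-congˡ (trans (PartialFractionExpansion.leading R₂) (*-congˡ (reflexive (last-∷ʳ 0# B)))))) ⟩
        - a * δ₂ * Δ * (δ₁ * last Q) - - a * δ₁ * r * (δ₂ * 0#)
          ≈⟨ solve 6 (λ d₁ d₂ Δ na q r → na :* d₂ :* Δ :* (d₁ :* q) :- na :* d₁ :* r :* (d₂ :* :0) := d₁ :* d₂ :* Δ :* (na :* q)) refl δ₁ δ₂ Δ (- a) (last Q) r ⟩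
        δ₁ * δ₂ * Δ * (- a * last Q)
          ≈⟨ *-congˡ (sym (last-quotient a P)) ⟩
        δ₁ * δ₂ * Δ * (a ^ suc m * last P)
          ≈⟨ sym (*-assoc (δ₁ * δ₂ * Δ) (a ^ suc m) (last P)) ⟩
        δ₁ * δ₂ * Δ * a ^ suc m * last P ∎
        where
        ℓ = product (λ i → - A′ i)
        Q = quotient a P

    expand : ∀ {m} (A : Fin m → Carrier) → Separated A → (P : Vec Carrier (suc m)) → All S P →
             PartialFractionExpansion A P
    expand {zero} A _ (p ∷ []) (p∈S ∷ []) = record
      { δ = 1# ; c₀ = p ; c = λ () ; δ∈M = M-1 ; δ∈S = S-1 ; c₀∈S = p∈S ; c∈S = λ ()
      ; identity = λ z → solve 2 (λ p z → :1 :* (p :+ z :* :0) := p :* :1 :+ :0) refl p z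
      ; leading  = *-comm p 1# }
    expand {suc m} A sep P P∈S = record
      { δ = δ ; c₀ = c₀ ; c = c
      ; δ∈M = M-* (M-* (M-* δ₁∈M δ₂∈M) Δ∈M) (M-^ (suc m) a∈M)
      ; δ∈S = S-* (S-* (S-* δ₁∈S δ₂∈S) Δ∈S) (S-^ (suc m) a∈S)
      ; c₀∈S = S-+ (S-* (S-* δ₂∈S Δ∈S) c₀₁∈S) (S-neg (S-* (S-* δ₁∈S r∈S) c₀₂∈S))
      ; c∈S = λ { zero → S-* (S-* (S-* δ₁∈S r∈S) δ₂∈S) (S-^ m a∈S)
                ; (suc i) → S-+ (S-* (S-* δ₂∈S Δ∈S) (c₁∈S i)) (S-neg (S-* (S-* δ₁∈S r∈S) (c₂∈S i))) }
      ; identity = identity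
      ; leading  = leading }
      where
      open Separated sep
      a  = A zero
      A′ = A ∘ suc
      a∈S = A∈S zero
      a∈M = A∈M zero
      D′∈S = S-denominatorCoeffs A′ (A∈S ∘ suc)
      B = quotient a (denominatorCoeffs A′)
      sep′ : Separated A′
      sep′ = record { A∈S = A∈S ∘ suc ; A∈M = A∈M ∘ suc ; A-A∈M = λ i≢j → A-A∈M (i≢j ∘ suc-injective) }
      R₁ = expand A′ sep′ (quotient a P) (S-quotient P a∈S P∈S)
      R₂ = expand A′ sep′ (B ∷ʳ 0#) (S-pad B (S-quotient (denominatorCoeffs A′) a∈S D′∈S))
      open ExpansionStep A P R₁ R₂ using (δ; c₀; c; r; Δ; identity; leading)
      open PartialFractionExpansion R₁ using () renaming (δ∈M to δ₁∈M; δ∈S to δ₁∈S; c₀∈S to c₀₁∈S; c∈S to c₁∈S)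
      open PartialFractionExpansion R₂ using () renaming (δ∈M to δ₂∈M; δ∈S to δ₂∈S; c₀∈S to c₀₂∈S; c∈S to c₂∈S)
      r∈S = S-remainder P a∈S P∈S
      Δ∈S = S-remainder (denominatorCoeffs A′) a∈S D′∈S
      Δ∈M : M Δ
      Δ∈M = M-resp (sym (remainder-denominatorCoeffs A′ a)) (M-product (λ i → a - A′ i) (λ i → A-A∈M {zero} {suc i} (λ ())))

    module _ {m} {A : Fin m → Carrier} {P : Vec Carrier (suc m)} (R : PartialFractionExpansion A P) where

      open PartialFractionExpansion R

      expansion-at-0 : δ * eval P 0# ≈ c₀ + sum c
      expansion-at-0 = begin
        δ * eval P 0#
          ≈⟨ identity 0# ⟩
        c₀ * denominator A 0# + sum (λ i → c i * cofactor A i 0#)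
          ≈⟨ +-cong (*-congˡ (denominator-0 A)) (sum-cong-≋ (λ i → *-congˡ (cofactor-0 A i))) ⟩
        c₀ * 1# + sum (λ i → c i * 1#)
          ≈⟨ +-cong (*-identityʳ c₀) (sum-cong-≋ (λ i → *-identityʳ (c i))) ⟩
        c₀ + sum c ∎

      expansion-at-units : ∀ {z T} (g : Fin m → Carrier) → (∀ i → g i * (1# - z * A i) ≈ 1#) →
                           T * denominator A z ≈ eval P z → δ * T ≈ c₀ + sum (λ i → c i * g i)
      expansion-at-units {z} {T} g g-inv TD≈P = begin
        δ * T                                                          ≈⟨ *-congˡ (sym (trans (*-congˡ (denominator*inverses A z g g-inv)) (*-identityʳ T))) ⟩
        δ * (T * (denominator A z * G))                                ≈⟨ solve 4 (λ d t x g → d :* (t :* (x :* g)) := d :* (t :* x) :* g) refl δ T (denominator A z) G ⟩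
        δ * (T * denominator A z) * G                                  ≈⟨ *-congʳ (*-congˡ TD≈P) ⟩
        δ * eval P z * G                                               ≈⟨ *-congʳ (identity z) ⟩
        (c₀ * denominator A z + sum (λ i → c i * cofactor A i z)) * G   ≈⟨ distribʳ G _ _ ⟩
        c₀ * denominator A z * G + sum (λ i → c i * cofactor A i z) * G ≈⟨ +-cong (*-assoc c₀ _ G) (*-distribʳ-sum G (λ i → c i * cofactor A i z)) ⟩
        c₀ * (denominator A z * G) + sum (λ i → c i * cofactor A i z * G)
          ≈⟨ +-cong (trans (*-congˡ (denominator*inverses A z g g-inv)) (*-identityʳ c₀))
                    (sum-cong-≋ (λ i → trans (*-assoc (c i) _ G) (*-congˡ (cofactor*inverses A z g g-inv i)))) ⟩
        c₀ + sum (λ i → c i * g i)                                     ∎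
        where G = product g

-- Opened only from here on: its _≈_ would clash with the equality of the generic rings above.
open import Defs

module PowerSeries where

  open import Data.Nat as ℕ using (ℕ; zero; suc; _≤_; s≤s)
  import Data.Nat.Properties as ℕ
  open import Data.Rational as ℚ using (ℚ; 0ℚ; 1ℚ)
  import Data.Rational.Properties as ℚ
  open import Data.Rational.Solver using (module +-*-Solver)
  open +-*-Solver using (solve; _:=_; _:+_; _:*_)
  open import Data.Sum using (_⊎_; inj₁; inj₂)
  open import Relation.Binary.PropositionalEquality
  open ≡-Reasoning
  open import Function using (_∘_)

  sumTo-front : ∀ n (h : ℕ → ℚ) → sumTo (suc n) h ≡ h 0 ℚ.+ sumTo n (h ∘ suc)
  sumTo-front zero    h = trans (ℚ.+-identityˡ (h 0)) (sym (ℚ.+-identityʳ (h 0)))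
  sumTo-front (suc n) h = begin
    sumTo (suc n) h ℚ.+ h (suc n)                ≡⟨ cong (ℚ._+ h (suc n)) (sumTo-front n h) ⟩
    (h 0 ℚ.+ sumTo n (h ∘ suc)) ℚ.+ h (suc n)    ≡⟨ ℚ.+-assoc (h 0) (sumTo n (h ∘ suc)) (h (suc n)) ⟩
    h 0 ℚ.+ (sumTo n (h ∘ suc) ℚ.+ h (suc n))    ∎

  -- The Cauchy product by recursion on the first factor, which is easier to reason about than conv.
  mul : PS → PS → PS
  mul f g zero    = f 0 ℚ.* g 0
  mul f g (suc n) = f 0 ℚ.* g (suc n) ℚ.+ mul (f ∘ suc) g n

  conv≗mul : ∀ f g → conv f g ≗ mul f g
  conv≗mul f g zero    = ℚ.+-identityˡ (f 0 ℚ.* g 0)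
  conv≗mul f g (suc n) =
    trans (sumTo-front (suc n) (λ i → f i ℚ.* g (suc n ℕ.∸ i))) (cong (f 0 ℚ.* g (suc n) ℚ.+_) (conv≗mul (f ∘ suc) g n))

  mul-cong : ∀ {f f′ g g′} → f ≗ f′ → g ≗ g′ → mul f g ≗ mul f′ g′
  mul-cong f≗f′ g≗g′ zero    = cong₂ ℚ._*_ (f≗f′ 0) (g≗g′ 0)
  mul-cong f≗f′ g≗g′ (suc n) = cong₂ ℚ._+_ (cong₂ ℚ._*_ (f≗f′ 0) (g≗g′ (suc n))) (mul-cong (f≗f′ ∘ suc) g≗g′ n)

  mul-sucʳ : ∀ f g n → mul f g (suc n) ≡ f (suc n) ℚ.* g 0 ℚ.+ mul f (g ∘ suc) n
  mul-sucʳ f g zero    = ℚ.+-comm (f 0 ℚ.* g 1) (f 1 ℚ.* g 0)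
  mul-sucʳ f g (suc n) = begin
    f 0 ℚ.* g (suc (suc n)) ℚ.+ mul (f ∘ suc) g (suc n)
      ≡⟨ cong (f 0 ℚ.* g (suc (suc n)) ℚ.+_) (mul-sucʳ (f ∘ suc) g n) ⟩
    f 0 ℚ.* g (suc (suc n)) ℚ.+ (f (suc (suc n)) ℚ.* g 0 ℚ.+ mul (f ∘ suc) (g ∘ suc) n)
      ≡⟨ solve 3 (λ a b c → a :+ (b :+ c) := b :+ (a :+ c)) refl (f 0 ℚ.* g (suc (suc n))) (f (suc (suc n)) ℚ.* g 0) (mul (f ∘ suc) (g ∘ suc) n) ⟩
    f (suc (suc n)) ℚ.* g 0 ℚ.+ (f 0 ℚ.* g (suc (suc n)) ℚ.+ mul (f ∘ suc) (g ∘ suc) n) ∎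

  mul-comm : ∀ f g → mul f g ≗ mul g f
  mul-comm f g zero    = ℚ.*-comm (f 0) (g 0)
  mul-comm f g (suc n) = begin
    f 0 ℚ.* g (suc n) ℚ.+ mul (f ∘ suc) g n   ≡⟨ cong₂ ℚ._+_ (ℚ.*-comm (f 0) (g (suc n))) (mul-comm (f ∘ suc) g n) ⟩
    g (suc n) ℚ.* f 0 ℚ.+ mul g (f ∘ suc) n   ≡⟨ mul-sucʳ g f n ⟨
    mul g f (suc n)                           ∎

  addPS : PS → PS → PS
  addPS f g n = f n ℚ.+ g n

  scalePS : ℚ → PS → PS
  scalePS c f n = c ℚ.* f n

  onePS : PS
  onePS zero    = 1ℚ
  onePS (suc _) = 0ℚ

  mul-distribʳ : ∀ f g h → mul (addPS f g) h ≗ addPS (mul f h) (mul g h)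
  mul-distribʳ f g h zero    = ℚ.*-distribʳ-+ (h 0) (f 0) (g 0)
  mul-distribʳ f g h (suc n) = begin
    (f 0 ℚ.+ g 0) ℚ.* h (suc n) ℚ.+ mul (addPS (f ∘ suc) (g ∘ suc)) h n
      ≡⟨ cong₂ ℚ._+_ (ℚ.*-distribʳ-+ (h (suc n)) (f 0) (g 0)) (mul-distribʳ (f ∘ suc) (g ∘ suc) h n) ⟩
    (f 0 ℚ.* h (suc n) ℚ.+ g 0 ℚ.* h (suc n)) ℚ.+ (mul (f ∘ suc) h n ℚ.+ mul (g ∘ suc) h n)
      ≡⟨ solve 4 (λ a b c d → (a :+ b) :+ (c :+ d) := (a :+ c) :+ (b :+ d)) refl (f 0 ℚ.* h (suc n)) (g 0 ℚ.* h (suc n)) (mul (f ∘ suc) h n) (mul (g ∘ suc) h n) ⟩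
    (f 0 ℚ.* h (suc n) ℚ.+ mul (f ∘ suc) h n) ℚ.+ (g 0 ℚ.* h (suc n) ℚ.+ mul (g ∘ suc) h n) ∎

  mul-scale : ∀ c f h → mul (scalePS c f) h ≗ scalePS c (mul f h)
  mul-scale c f h zero    = ℚ.*-assoc c (f 0) (h 0)
  mul-scale c f h (suc n) = begin
    c ℚ.* f 0 ℚ.* h (suc n) ℚ.+ mul (scalePS c (f ∘ suc)) h n
      ≡⟨ cong₂ ℚ._+_ (ℚ.*-assoc c (f 0) (h (suc n))) (mul-scale c (f ∘ suc) h n) ⟩
    c ℚ.* (f 0 ℚ.* h (suc n)) ℚ.+ c ℚ.* mul (f ∘ suc) h n
      ≡⟨ ℚ.*-distribˡ-+ c (f 0 ℚ.* h (suc n)) (mul (f ∘ suc) h n) ⟨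
    c ℚ.* (f 0 ℚ.* h (suc n) ℚ.+ mul (f ∘ suc) h n) ∎

  mul-assoc : ∀ f g h → mul (mul f g) h ≗ mul f (mul g h)
  mul-assoc f g h zero    = ℚ.*-assoc (f 0) (g 0) (h 0)
  mul-assoc f g h (suc n) = begin
    fg0 ℚ.* h (suc n) ℚ.+ mul (mul f g ∘ suc) h n
      ≡⟨ cong (fg0 ℚ.* h (suc n) ℚ.+_) (mul-distribʳ (scalePS (f 0) (g ∘ suc)) (mul (f ∘ suc) g) h n) ⟩
    fg0 ℚ.* h (suc n) ℚ.+ (mul (scalePS (f 0) (g ∘ suc)) h n ℚ.+ mul (mul (f ∘ suc) g) h n)
      ≡⟨ cong₂ (λ u v → fg0 ℚ.* h (suc n) ℚ.+ (u ℚ.+ v)) (mul-scale (f 0) (g ∘ suc) h n) (mul-assoc (f ∘ suc) g h n) ⟩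
    f 0 ℚ.* g 0 ℚ.* h (suc n) ℚ.+ (f 0 ℚ.* mul (g ∘ suc) h n ℚ.+ mul (f ∘ suc) (mul g h) n)
      ≡⟨ solve 5 (λ a b c d e → a :* b :* c :+ (a :* d :+ e) := a :* (b :* c :+ d) :+ e) refl (f 0) (g 0) (h (suc n)) (mul (g ∘ suc) h n) (mul (f ∘ suc) (mul g h) n) ⟩
    f 0 ℚ.* mul g h (suc n) ℚ.+ mul (f ∘ suc) (mul g h) n ∎
    where fg0 = f 0 ℚ.* g 0

  mul-zeroˡ : ∀ g → mul (λ _ → 0ℚ) g ≗ (λ _ → 0ℚ)
  mul-zeroˡ g zero    = ℚ.*-zeroˡ (g 0)
  mul-zeroˡ g (suc n) = trans (cong₂ ℚ._+_ (ℚ.*-zeroˡ (g (suc n))) (mul-zeroˡ g n)) (ℚ.+-identityˡ 0ℚ)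

  mul-identityˡ : ∀ g → mul onePS g ≗ g
  mul-identityˡ g zero    = ℚ.*-identityˡ (g 0)
  mul-identityˡ g (suc n) = trans (cong₂ ℚ._+_ (ℚ.*-identityˡ (g (suc n))) (mul-zeroˡ g n)) (ℚ.+-identityʳ (g (suc n)))

  mul-shift : ∀ j f g → mul (shiftPS j f) g ≗ shiftPS j (mul f g)
  mul-shift zero    f g n       = refl
  mul-shift (suc j) f g zero    = ℚ.*-zeroˡ (g 0)
  mul-shift (suc j) f g (suc n) =
    trans (cong₂ ℚ._+_ (ℚ.*-zeroˡ (g (suc n))) (mul-shift j f g n)) (ℚ.+-identityˡ (shiftPS j (mul f g) n))

  *-≡0 : ∀ {a b} → a ≡ 0ℚ ⊎ b ≡ 0ℚ → a ℚ.* b ≡ 0ℚ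
  *-≡0 {a} {b} (inj₁ a≡0) = trans (cong (ℚ._* b) a≡0) (ℚ.*-zeroˡ b)
  *-≡0 {a} {b} (inj₂ b≡0) = trans (cong (a ℚ.*_) b≡0) (ℚ.*-zeroʳ a)

  *-≢0 : ∀ {a b} → a ≢ 0ℚ → b ≢ 0ℚ → a ℚ.* b ≢ 0ℚ
  *-≢0 {a} {b} a≢0 b≢0 ab≡0 = b≢0 (begin
    b                      ≡⟨ ℚ.*-identityˡ b ⟨
    1ℚ ℚ.* b               ≡⟨ cong (ℚ._* b) (ℚ.*-inverseˡ a) ⟨
    ℚ.1/ a ℚ.* a ℚ.* b     ≡⟨ ℚ.*-assoc (ℚ.1/ a) a b ⟩
    ℚ.1/ a ℚ.* (a ℚ.* b)   ≡⟨ cong (ℚ.1/ a ℚ.*_) ab≡0 ⟩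
    ℚ.1/ a ℚ.* 0ℚ          ≡⟨ ℚ.*-zeroʳ (ℚ.1/ a) ⟩
    0ℚ                     ∎)
    where
    instance
      a-nonZero : ℚ.NonZero a
      a-nonZero = ℚ.≢-nonZero a≢0

  mul-vanishes : ∀ n f g → (∀ i j → i ℕ.+ j ≡ n → f i ≡ 0ℚ ⊎ g j ≡ 0ℚ) → mul f g n ≡ 0ℚ
  mul-vanishes zero    f g split = *-≡0 (split 0 0 refl)
  mul-vanishes (suc n) f g split = begin
    f 0 ℚ.* g (suc n) ℚ.+ mul (f ∘ suc) g n  ≡⟨ cong₂ ℚ._+_ (*-≡0 (split 0 (suc n) refl)) (mul-vanishes n (f ∘ suc) g split′) ⟩
    0ℚ ℚ.+ 0ℚ                                ≡⟨ ℚ.+-identityˡ 0ℚ ⟩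
    0ℚ                                       ∎
    where
    split′ : ∀ i j → i ℕ.+ j ≡ n → f (suc i) ≡ 0ℚ ⊎ g j ≡ 0ℚ
    split′ i j i+j≡n = split (suc i) j (cong suc i+j≡n)

  mul-cancel : ∀ f g → g 0 ≡ 1ℚ → (∀ n → mul f g n ≡ 0ℚ) → ∀ n → f n ≡ 0ℚ
  mul-cancel f g g0≡1 fg≡0 n = upTo n n ℕ.≤-refl
    where
    upTo : ∀ n j → j ≤ n → f j ≡ 0ℚ
    upTo zero zero _ = begin
      f 0               ≡⟨ ℚ.*-identityʳ (f 0) ⟨
      f 0 ℚ.* 1ℚ        ≡⟨ cong (f 0 ℚ.*_) g0≡1 ⟨
      f 0 ℚ.* g 0       ≡⟨ fg≡0 0 ⟩
      0ℚ                ∎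
    upTo (suc n) j j≤1+n with ℕ.m≤n⇒m<n∨m≡n j≤1+n
    ... | inj₁ (s≤s j≤n) = upTo n j j≤n
    ... | inj₂ refl = begin
      f (suc n)                                          ≡⟨ ℚ.*-identityʳ (f (suc n)) ⟨
      f (suc n) ℚ.* 1ℚ                                   ≡⟨ cong (f (suc n) ℚ.*_) g0≡1 ⟨
      f (suc n) ℚ.* g 0                                  ≡⟨ ℚ.+-identityʳ _ ⟨
      f (suc n) ℚ.* g 0 ℚ.+ 0ℚ                           ≡⟨ cong (f (suc n) ℚ.* g 0 ℚ.+_) (mul-vanishes n f (g ∘ suc) earlier) ⟨
      f (suc n) ℚ.* g 0 ℚ.+ mul f (g ∘ suc) n            ≡⟨ mul-sucʳ f g n ⟨
      mul f g (suc n)                                    ≡⟨ fg≡0 (suc n) ⟩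
      0ℚ                                                 ∎
      where
      earlier : ∀ i j → i ℕ.+ j ≡ n → f i ≡ 0ℚ ⊎ g (suc j) ≡ 0ℚ
      earlier i j i+j≡n = inj₁ (upTo n i (subst (i ≤_) i+j≡n (ℕ.m≤m+n i j)))

module LaurentSeries where

  open PowerSeries
  open import Data.Nat as ℕ using (ℕ; zero; suc; s≤s)
  import Data.Nat.Properties as ℕ
  open import Data.Integer as ℤ using (ℤ; +_; -[1+_])
  import Data.Integer.Properties as ℤ
  open import Data.Integer.Solver using (module +-*-Solver)
  open import Data.Rational as ℚ using (ℚ; 0ℚ)
  import Data.Rational.Properties as ℚ
  open import Data.Product using (_,_)
  open +-*-Solver using (solve; _:=_; _:+_; _:-_)
  open import Relation.Binary.PropositionalEquality
  open ≡-Reasoning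
  open import Function using (_∘_)

  shiftPS-below : ∀ j f n → n ℕ.< j → shiftPS j f n ≡ 0ℚ
  shiftPS-below (suc j) f zero    _         = refl
  shiftPS-below (suc j) f (suc n) (s≤s n<j) = shiftPS-below j f n n<j

  shiftPS-+ : ∀ j f n → shiftPS j f (j ℕ.+ n) ≡ f n
  shiftPS-+ zero    f n = refl
  shiftPS-+ (suc j) f n = shiftPS-+ j f n

  atℤ-⊖ : ∀ (g : PS) j i → (∀ n → n ℕ.< j → g n ≡ 0ℚ) → atℤ g (j ℤ.⊖ suc i) ≡ 0ℚ
  atℤ-⊖ g zero    i       _   = refl
  atℤ-⊖ g (suc j) zero    g≡0 = trans (cong (atℤ g) (ℤ.[1+m]⊖[1+n]≡m⊖n j 0)) (g≡0 j (ℕ.n<1+n j))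
  atℤ-⊖ g (suc j) (suc i) g≡0 =
    trans (cong (atℤ g) (ℤ.[1+m]⊖[1+n]≡m⊖n j (suc i))) (atℤ-⊖ g j i (λ n n<j → g≡0 n (ℕ.m<n⇒m<1+n n<j)))

  atℤ-shiftPS : ∀ j f x → atℤ (shiftPS j f) (x ℤ.+ + j) ≡ atℤ f x
  atℤ-shiftPS j f (+ n)    = trans (cong (shiftPS j f) (ℕ.+-comm n j)) (shiftPS-+ j f n)
  atℤ-shiftPS j f -[1+ i ] = atℤ-⊖ (shiftPS j f) j i (shiftPS-below j f)

  atℤ-shiftPS′ : ∀ j f e a b → a ≡ b ℕ.+ j → atℤ (shiftPS j f) (e ℤ.+ + a) ≡ atℤ f (e ℤ.+ + b)
  atℤ-shiftPS′ j f e a b refl = begin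
    atℤ (shiftPS j f) (e ℤ.+ + (b ℕ.+ j))     ≡⟨ cong (λ x → atℤ (shiftPS j f) (e ℤ.+ x)) (ℤ.pos-+ b j) ⟩
    atℤ (shiftPS j f) (e ℤ.+ (+ b ℤ.+ + j))   ≡⟨ cong (atℤ (shiftPS j f)) (ℤ.+-assoc e (+ b) (+ j)) ⟨
    atℤ (shiftPS j f) (e ℤ.+ + b ℤ.+ + j)     ≡⟨ atℤ-shiftPS j f (e ℤ.+ + b) ⟩
    atℤ f (e ℤ.+ + b)                         ∎

  atℤ-addPS : ∀ f g x → atℤ (addPS f g) x ≡ atℤ f x ℚ.+ atℤ g x
  atℤ-addPS f g (+ n)    = refl
  atℤ-addPS f g -[1+ n ] = sym (ℚ.+-identityˡ 0ℚ)

  atℤ-zero : ∀ {f} → (∀ n → f n ≡ 0ℚ) → ∀ x → atℤ f x ≡ 0ℚ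
  atℤ-zero f≡0 (+ n)    = f≡0 n
  atℤ-zero f≡0 -[1+ n ] = refl

  atℤ-cong : ∀ {f g} → f ≗ g → ∀ x → atℤ f x ≡ atℤ g x
  atℤ-cong f≗g (+ n)    = f≗g n
  atℤ-cong f≗g -[1+ n ] = refl

  coeffL-+ : ∀ A B e → coeffL (A +L B) e ≡ coeffL A e ℚ.+ coeffL B e
  coeffL-+ ⟨ k , f ⟩ ⟨ l , g ⟩ e = trans (atℤ-addPS (shiftPS l f) (shiftPS k g) (e ℤ.+ + (k ℕ.+ l)))
    (cong₂ ℚ._+_ (atℤ-shiftPS′ l f e (k ℕ.+ l) k refl) (atℤ-shiftPS′ k g e (k ℕ.+ l) l (ℕ.+-comm k l)))

  coeffL-neg : ∀ A e → coeffL (negL A) e ≡ ℚ.- coeffL A e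
  coeffL-neg ⟨ k , f ⟩ e with e ℤ.+ + k
  ... | + n      = refl
  ... | -[1+ n ] = refl

  coeffL-0 : ∀ e → coeffL 0L e ≡ 0ℚ
  coeffL-0 e with e ℤ.+ + 0
  ... | + zero   = refl
  ... | + suc n  = refl
  ... | -[1+ n ] = refl

  ≈-refl : ∀ {A} → A ≈ A
  ≈-refl e = refl

  ≈-sym : ∀ {A B} → A ≈ B → B ≈ A
  ≈-sym A≈B e = sym (A≈B e)

  ≈-trans : ∀ {A B D} → A ≈ B → B ≈ D → A ≈ D
  ≈-trans A≈B B≈D e = trans (A≈B e) (B≈D e)

  ⟨⟩-cong : ∀ {k k′ f g} → k ≡ k′ → f ≗ g → ⟨ k , f ⟩ ≈ ⟨ k′ , g ⟩
  ⟨⟩-cong {k} refl f≗g e = atℤ-cong f≗g (e ℤ.+ + k)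

  ⟨⟩-raise : ∀ k f j → ⟨ k , f ⟩ ≈ ⟨ k ℕ.+ j , shiftPS j f ⟩
  ⟨⟩-raise k f j e = sym (atℤ-shiftPS′ j f e (k ℕ.+ j) k refl)

  ⟨⟩-injective : ∀ {k f g} → ⟨ k , f ⟩ ≈ ⟨ k , g ⟩ → f ≗ g
  ⟨⟩-injective {k} {f} {g} f≈g n = subst (λ x → atℤ f x ≡ atℤ g x) (solve 2 (λ n k → n :- k :+ k := n) refl (+ n) (+ k)) (f≈g (+ n ℤ.- + k))

  *L-mul : ∀ k f l g → ⟨ k , f ⟩ *L ⟨ l , g ⟩ ≈ ⟨ k ℕ.+ l , mul f g ⟩
  *L-mul k f l g = ⟨⟩-cong refl (conv≗mul f g)

  *-raiseˡ : ∀ k f j B → ⟨ k , f ⟩ *L B ≈ ⟨ k ℕ.+ j , shiftPS j f ⟩ *L B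
  *-raiseˡ k f j ⟨ l , g ⟩ =
    ≈-trans (*L-mul k f l g) (≈-trans (⟨⟩-raise (k ℕ.+ l) (mul f g) j)
      (≈-trans (⟨⟩-cong order (λ n → sym (mul-shift j f g n))) (≈-sym (*L-mul (k ℕ.+ j) (shiftPS j f) l g))))
    where
    order : k ℕ.+ l ℕ.+ j ≡ k ℕ.+ j ℕ.+ l
    order = trans (ℕ.+-assoc k l j) (trans (cong (k ℕ.+_) (ℕ.+-comm l j)) (sym (ℕ.+-assoc k j l)))

  -- Unlike the ring bundle's congruences, the ones here take the fixed operand explicitly: as _≈_ unfolds
  -- to a statement about coefficients, that operand cannot be inferred from the goal.
  *-congʳ : ∀ {A A′} B → A ≈ A′ → A *L B ≈ A′ *L B
  *-congʳ {⟨ k , f ⟩} {⟨ k′ , f′ ⟩} ⟨ l , g ⟩ A≈A′ =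
    ≈-trans (*-raiseˡ k f k′ B) (≈-trans same-order (≈-sym (*-raiseˡ k′ f′ k B)))
    where
    B = ⟨ l , g ⟩
    raised : shiftPS k′ f ≗ shiftPS k f′
    raised = ⟨⟩-injective (≈-trans (≈-sym (⟨⟩-raise k f k′))
               (≈-trans A≈A′ (≈-trans (⟨⟩-raise k′ f′ k) (⟨⟩-cong (ℕ.+-comm k′ k) (λ _ → refl)))))
    same-order : ⟨ k ℕ.+ k′ , shiftPS k′ f ⟩ *L B ≈ ⟨ k′ ℕ.+ k , shiftPS k f′ ⟩ *L B
    same-order = ≈-trans (*L-mul _ _ l g)
                   (≈-trans (⟨⟩-cong (cong (ℕ._+ l) (ℕ.+-comm k k′)) (mul-cong raised (λ _ → refl))) (≈-sym (*L-mul _ _ l g)))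

  *-comm : ∀ A B → A *L B ≈ B *L A
  *-comm ⟨ k , f ⟩ ⟨ l , g ⟩ = ≈-trans (*L-mul k f l g) (≈-trans (⟨⟩-cong (ℕ.+-comm k l) (mul-comm f g)) (≈-sym (*L-mul l g k f)))

  *-congˡ : ∀ A {B B′} → B ≈ B′ → A *L B ≈ A *L B′
  *-congˡ A {B} {B′} B≈B′ = ≈-trans (*-comm A B) (≈-trans (*-congʳ A B≈B′) (*-comm B′ A))

  *-cong : ∀ {A A′ B B′} → A ≈ A′ → B ≈ B′ → A *L B ≈ A′ *L B′
  *-cong {A} {A′} {B} {B′} A≈A′ B≈B′ = ≈-trans (*-congʳ B A≈A′) (*-congˡ A′ B≈B′)

  *-assoc : ∀ A B D → (A *L B) *L D ≈ A *L (B *L D)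
  *-assoc ⟨ k , f ⟩ ⟨ l , g ⟩ ⟨ m , h ⟩ = ⟨⟩-cong (ℕ.+-assoc k l m) λ n → begin
    conv (conv f g) h n  ≡⟨ conv≗mul (conv f g) h n ⟩
    mul (conv f g) h n   ≡⟨ mul-cong (conv≗mul f g) (λ _ → refl) n ⟩
    mul (mul f g) h n    ≡⟨ mul-assoc f g h n ⟩
    mul f (mul g h) n    ≡⟨ mul-cong (λ _ → refl) (conv≗mul g h) n ⟨
    mul f (conv g h) n   ≡⟨ conv≗mul f (conv g h) n ⟨
    conv f (conv g h) n  ∎

  ser-1L : ser 1L ≗ onePS
  ser-1L zero    = refl
  ser-1L (suc n) = refl

  *-identityˡ : ∀ A → 1L *L A ≈ A
  *-identityˡ ⟨ k , f ⟩ = ≈-trans (*L-mul 0 _ k f) (⟨⟩-cong refl (λ n → trans (mul-cong ser-1L (λ _ → refl) n) (mul-identityˡ f n)))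

  *-identityʳ : ∀ A → A *L 1L ≈ A
  *-identityʳ A = ≈-trans (*-comm A 1L) (*-identityˡ A)

  +-comm : ∀ A B → A +L B ≈ B +L A
  +-comm A B e = trans (coeffL-+ A B e) (trans (ℚ.+-comm (coeffL A e) (coeffL B e)) (sym (coeffL-+ B A e)))

  +-assoc : ∀ A B D → (A +L B) +L D ≈ A +L (B +L D)
  +-assoc A B D e = begin
    coeffL ((A +L B) +L D) e                     ≡⟨ coeffL-+ (A +L B) D e ⟩
    coeffL (A +L B) e ℚ.+ coeffL D e             ≡⟨ cong (ℚ._+ coeffL D e) (coeffL-+ A B e) ⟩
    (coeffL A e ℚ.+ coeffL B e) ℚ.+ coeffL D e   ≡⟨ ℚ.+-assoc (coeffL A e) (coeffL B e) (coeffL D e) ⟩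
    coeffL A e ℚ.+ (coeffL B e ℚ.+ coeffL D e)   ≡⟨ cong (coeffL A e ℚ.+_) (coeffL-+ B D e) ⟨
    coeffL A e ℚ.+ coeffL (B +L D) e             ≡⟨ coeffL-+ A (B +L D) e ⟨
    coeffL (A +L (B +L D)) e                     ∎

  +-cong : ∀ {A A′ B B′} → A ≈ A′ → B ≈ B′ → A +L B ≈ A′ +L B′
  +-cong {A} {A′} {B} {B′} A≈A′ B≈B′ e = trans (coeffL-+ A B e) (trans (cong₂ ℚ._+_ (A≈A′ e) (B≈B′ e)) (sym (coeffL-+ A′ B′ e)))

  +-identityˡ : ∀ A → 0L +L A ≈ A
  +-identityˡ A e = trans (coeffL-+ 0L A e) (trans (cong (ℚ._+ coeffL A e) (coeffL-0 e)) (ℚ.+-identityˡ _))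

  +-identityʳ : ∀ A → A +L 0L ≈ A
  +-identityʳ A = ≈-trans (+-comm A 0L) (+-identityˡ A)

  +-congˡ : ∀ A {B B′} → B ≈ B′ → A +L B ≈ A +L B′
  +-congˡ A = +-cong (≈-refl {A})

  +-congʳ : ∀ {A A′} B → A ≈ A′ → A +L B ≈ A′ +L B
  +-congʳ B A≈A′ = +-cong A≈A′ (≈-refl {B})

  -‿cong : ∀ {A A′} → A ≈ A′ → negL A ≈ negL A′
  -‿cong {A} {A′} A≈A′ e = trans (coeffL-neg A e) (trans (cong ℚ.-_ (A≈A′ e)) (sym (coeffL-neg A′ e)))

  -‿inverseˡ : ∀ A → negL A +L A ≈ 0L
  -‿inverseˡ A e = begin
    coeffL (negL A +L A) e              ≡⟨ coeffL-+ (negL A) A e ⟩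
    coeffL (negL A) e ℚ.+ coeffL A e    ≡⟨ cong (ℚ._+ coeffL A e) (coeffL-neg A e) ⟩
    ℚ.- coeffL A e ℚ.+ coeffL A e       ≡⟨ ℚ.+-inverseˡ (coeffL A e) ⟩
    0ℚ                                  ≡⟨ coeffL-0 e ⟨
    coeffL 0L e                         ∎

  -‿inverseʳ : ∀ A → A +L negL A ≈ 0L
  -‿inverseʳ A = ≈-trans (+-comm A (negL A)) (-‿inverseˡ A)

  distribʳ : ∀ D A B → (A +L B) *L D ≈ (A *L D) +L (B *L D)
  distribʳ ⟨ m , h ⟩ ⟨ k , f ⟩ ⟨ l , g ⟩ e = begin
    coeffL (⟨ k ℕ.+ l , addPS (shiftPS l f) (shiftPS k g) ⟩ *L ⟨ m , h ⟩) e
      ≡⟨ *L-mul (k ℕ.+ l) (addPS (shiftPS l f) (shiftPS k g)) m h e ⟩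
    atℤ (mul (addPS (shiftPS l f) (shiftPS k g)) h) x
      ≡⟨ atℤ-cong (λ n → trans (mul-distribʳ (shiftPS l f) (shiftPS k g) h n) (cong₂ ℚ._+_ (mul-shift l f h n) (mul-shift k g h n))) x ⟩
    atℤ (addPS (shiftPS l (mul f h)) (shiftPS k (mul g h))) x
      ≡⟨ atℤ-addPS (shiftPS l (mul f h)) (shiftPS k (mul g h)) x ⟩
    atℤ (shiftPS l (mul f h)) x ℚ.+ atℤ (shiftPS k (mul g h)) x
      ≡⟨ cong₂ ℚ._+_ (atℤ-shiftPS′ l (mul f h) e _ (k ℕ.+ m) order₁) (atℤ-shiftPS′ k (mul g h) e _ (l ℕ.+ m) order₂) ⟩
    atℤ (mul f h) (e ℤ.+ + (k ℕ.+ m)) ℚ.+ atℤ (mul g h) (e ℤ.+ + (l ℕ.+ m))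
      ≡⟨ cong₂ ℚ._+_ (*L-mul k f m h e) (*L-mul l g m h e) ⟨
    coeffL (⟨ k , f ⟩ *L ⟨ m , h ⟩) e ℚ.+ coeffL (⟨ l , g ⟩ *L ⟨ m , h ⟩) e
      ≡⟨ coeffL-+ (⟨ k , f ⟩ *L ⟨ m , h ⟩) (⟨ l , g ⟩ *L ⟨ m , h ⟩) e ⟨
    coeffL ((⟨ k , f ⟩ *L ⟨ m , h ⟩) +L (⟨ l , g ⟩ *L ⟨ m , h ⟩)) e ∎
    where
    x = e ℤ.+ + (k ℕ.+ l ℕ.+ m)
    order₁ : k ℕ.+ l ℕ.+ m ≡ k ℕ.+ m ℕ.+ l
    order₁ = trans (ℕ.+-assoc k l m) (trans (cong (k ℕ.+_) (ℕ.+-comm l m)) (sym (ℕ.+-assoc k m l)))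
    order₂ : k ℕ.+ l ℕ.+ m ≡ l ℕ.+ m ℕ.+ k
    order₂ = trans (ℕ.+-assoc k l m) (ℕ.+-comm k (l ℕ.+ m))

  distribˡ : ∀ D A B → D *L (A +L B) ≈ (D *L A) +L (D *L B)
  distribˡ D A B = ≈-trans (*-comm D (A +L B)) (≈-trans (distribʳ D A B) (+-cong (*-comm A D) (*-comm B D)))

  +-*-commutativeRing : CommutativeRing 0ℓ 0ℓ
  +-*-commutativeRing = record
    { Carrier = Laurent ; _≈_ = _≈_ ; _+_ = _+L_ ; _*_ = _*L_ ; -_ = negL ; 0# = 0L ; 1# = 1L
    ; isCommutativeRing = record
      { isRing = record
        { +-isAbelianGroup = record
          { isGroup = record
            { isMonoid = record
              { isSemigroup = record
                { isMagma = record
                  { isEquivalence = record { refl = ≈-refl ; sym = ≈-sym ; trans = ≈-trans }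
                  ; ∙-cong = +-cong }
                ; assoc = +-assoc }
              ; identity = +-identityˡ , +-identityʳ }
            ; inverse = -‿inverseˡ , -‿inverseʳ
            ; ⁻¹-cong = -‿cong }
          ; comm = +-comm }
        ; *-cong = *-cong
        ; *-assoc = *-assoc
        ; *-identity = *-identityˡ , *-identityʳ
        ; distrib = distribˡ , distribʳ }
      ; *-comm = *-comm } }

  powL-+ : ∀ A k l → powL A (k ℕ.+ l) ≈ powL A k *L powL A l
  powL-+ A zero    l = ≈-sym (*-identityˡ (powL A l))
  powL-+ A (suc k) l = ≈-trans (*-congˡ A (powL-+ A k l)) (≈-sym (*-assoc A (powL A k) (powL A l)))

  constL-+ : ∀ a b → constL (a ℚ.+ b) ≈ constL a +L constL b
  constL-+ a b = ⟨⟩-cong refl λ { zero → refl ; (suc n) → sym (ℚ.+-identityʳ 0ℚ) }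

  constL-* : ∀ a b → constL (a ℚ.* b) ≈ constL a *L constL b
  constL-* a b = ≈-sym (≈-trans (*L-mul 0 _ 0 _) (⟨⟩-cong refl product))
    where
    product : mul (ser (constL a)) (ser (constL b)) ≗ ser (constL (a ℚ.* b))
    product zero    = refl
    product (suc n) = trans (cong₂ ℚ._+_ (ℚ.*-zeroʳ a) (mul-zeroˡ (ser (constL b)) n)) (ℚ.+-identityˡ 0ℚ)

  constL-neg : ∀ a → constL (ℚ.- a) ≈ negL (constL a)
  constL-neg a = ⟨⟩-cong refl λ { zero → refl ; (suc n) → refl }

module PolynomialsInC where

  open PowerSeries using (mul; mul-comm; mul-cancel; *-≢0)
  open LaurentSeries using (+-*-commutativeRing; powL-+; ≈-sym; ≈-trans; atℤ-zero; ⟨⟩-injective; *L-mul; coeffL-0; constL-+; constL-*; constL-neg)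
  open CommutativeRing +-*-commutativeRing hiding (_≈_; zero; +-congˡ; +-congʳ; *-congˡ; *-congʳ)
  open LaurentSeries using (+-congˡ; +-congʳ; *-congˡ; *-congʳ)
  open import Algebra.Properties.CommutativeMonoid.Sum *-commutativeMonoid using () renaming (sum to product)
  open import Algebra.Properties.Semiring.Sum semiring using (sum)
  open import Algebra.Properties.Ring ring using (-0#≈0#)
  open IntegerCoefficientSolver +-*-commutativeRing
  open import Relation.Binary.Reasoning.Setoid setoid
  open import Data.Nat as ℕ using (ℕ; zero; suc)
  import Data.Nat.Properties as ℕ
  open import Data.Integer as ℤ using (+_)
  open import Data.Rational as ℚ using (ℚ; 0ℚ; 1ℚ)
  import Data.Rational.Properties as ℚ
  open import Relation.Binary.Definitions using (tri<; tri≈; tri>)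
  open import Data.Empty using (⊥; ⊥-elim)
  open import Data.Fin using (Fin; zero; suc)
  open import Data.List using (List; []; _∷_; replicate; _++_)
  open import Data.List.Relation.Unary.Any using (here; there)
  open import Data.Product using (Σ; _×_; _,_)
  open import Relation.Nullary using (¬_; yes; no)
  import Relation.Binary.PropositionalEquality as ≡
  open ≡ using (_≡_; _≢_)
  open import Function using (_∘_)

  addQ : List ℚ → List ℚ → List ℚ
  addQ []      q       = q
  addQ (a ∷ p) []      = a ∷ p
  addQ (a ∷ p) (b ∷ q) = (a ℚ.+ b) ∷ addQ p q

  scaleQ : ℚ → List ℚ → List ℚ
  scaleQ a []      = []
  scaleQ a (b ∷ q) = (a ℚ.* b) ∷ scaleQ a q

  mulQ : List ℚ → List ℚ → List ℚ
  mulQ []      q = []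
  mulQ (a ∷ p) q = addQ (scaleQ a q) (0ℚ ∷ mulQ p q)

  evalC-addQ : ∀ p q → evalC (addQ p q) ≈ evalC p + evalC q
  evalC-addQ []      q       = sym (+-identityˡ (evalC q))
  evalC-addQ (a ∷ p) []      = sym (+-identityʳ (evalC (a ∷ p)))
  evalC-addQ (a ∷ p) (b ∷ q) = begin
    constL (a ℚ.+ b) + C * evalC (addQ p q)               ≈⟨ +-cong (constL-+ a b) (*-congˡ C (evalC-addQ p q)) ⟩
    (constL a + constL b) + C * (evalC p + evalC q)       ≈⟨ solve 5 (λ x y c u v → (x :+ y) :+ c :* (u :+ v)
                                                                      := (x :+ c :* u) :+ (y :+ c :* v)) refl (constL a) (constL b) C (evalC p) (evalC q) ⟩
    (constL a + C * evalC p) + (constL b + C * evalC q)   ∎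

  evalC-scaleQ : ∀ a q → evalC (scaleQ a q) ≈ constL a * evalC q
  evalC-scaleQ a []      = sym (zeroʳ (constL a))
  evalC-scaleQ a (b ∷ q) = begin
    constL (a ℚ.* b) + C * evalC (scaleQ a q)      ≈⟨ +-cong (constL-* a b) (*-congˡ C (evalC-scaleQ a q)) ⟩
    constL a * constL b + C * (constL a * evalC q) ≈⟨ solve 4 (λ x y c u → x :* y :+ c :* (x :* u) := x :* (y :+ c :* u)) refl (constL a) (constL b) C (evalC q) ⟩
    constL a * (constL b + C * evalC q)            ∎

  evalC-mulQ : ∀ p q → evalC (mulQ p q) ≈ evalC p * evalC q
  evalC-mulQ []      q = sym (zeroˡ (evalC q))
  evalC-mulQ (a ∷ p) q = begin
    evalC (addQ (scaleQ a q) (0ℚ ∷ mulQ p q))                  ≈⟨ evalC-addQ (scaleQ a q) (0ℚ ∷ mulQ p q) ⟩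
    evalC (scaleQ a q) + (constL 0ℚ + C * evalC (mulQ p q))    ≈⟨ +-cong (evalC-scaleQ a q) (+-congˡ 0L (*-congˡ C (evalC-mulQ p q))) ⟩
    constL a * evalC q + (0L + C * (evalC p * evalC q))        ≈⟨ solve 4 (λ x y c u → x :* y :+ (con (+ 0) :+ c :* (u :* y))
                                                                           := (x :+ c :* u) :* y) refl (constL a) (evalC q) C (evalC p) ⟩
    (constL a + C * evalC p) * evalC q                         ∎

  evalC-neg : ∀ p → evalC (scaleQ (ℚ.- 1ℚ) p) ≈ - evalC p
  evalC-neg p = begin
    evalC (scaleQ (ℚ.- 1ℚ) p)  ≈⟨ evalC-scaleQ (ℚ.- 1ℚ) p ⟩
    constL (ℚ.- 1ℚ) * evalC p  ≈⟨ *-congʳ (evalC p) (constL-neg 1ℚ) ⟩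
    - 1L * evalC p             ≈⟨ solve 1 (λ x → :- con (+ 1) :* x := :- x) refl (evalC p) ⟩
    - evalC p                  ∎

  evalC-1 : evalC (1ℚ ∷ []) ≈ 1L
  evalC-1 = trans (+-congˡ 1L (zeroʳ C)) (+-identityʳ 1L)

  evalC-zeros : ∀ k p → evalC (replicate k 0ℚ ++ p) ≈ powL C k * evalC p
  evalC-zeros zero    p = sym (*-identityˡ (evalC p))
  evalC-zeros (suc k) p = begin
    0L + C * evalC (replicate k 0ℚ ++ p)  ≈⟨ +-identityˡ _ ⟩
    C * evalC (replicate k 0ℚ ++ p)       ≈⟨ *-congˡ C (evalC-zeros k p) ⟩
    C * (powL C k * evalC p)              ≈⟨ *-assoc C (powL C k) (evalC p) ⟨
    C * powL C k * evalC p                ∎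

  monomialQ : ℕ → List ℚ
  monomialQ k = replicate k 0ℚ ++ (1ℚ ∷ [])

  evalC-monomialQ : ∀ k → evalC (monomialQ k) ≈ powL C k
  evalC-monomialQ k = trans (evalC-zeros k (1ℚ ∷ [])) (trans (*-congˡ (powL C k) evalC-1) (*-identityʳ (powL C k)))

  IsPolyC : Laurent → Set
  IsPolyC X = Σ (List ℚ) λ p → X ≈ evalC p

  IsPolyC-resp : ∀ {X Y} → X ≈ Y → IsPolyC X → IsPolyC Y
  IsPolyC-resp X≈Y (p , X≈p) = p , trans (sym X≈Y) X≈p

  IsPolyC-0 : IsPolyC 0L
  IsPolyC-0 = [] , refl

  IsPolyC-1 : IsPolyC 1L
  IsPolyC-1 = 1ℚ ∷ [] , sym evalC-1

  IsPolyC-+ : ∀ {X Y} → IsPolyC X → IsPolyC Y → IsPolyC (X + Y)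
  IsPolyC-+ (p , X≈p) (q , Y≈q) = addQ p q , trans (+-cong X≈p Y≈q) (sym (evalC-addQ p q))

  IsPolyC-* : ∀ {X Y} → IsPolyC X → IsPolyC Y → IsPolyC (X * Y)
  IsPolyC-* (p , X≈p) (q , Y≈q) = mulQ p q , trans (*-cong X≈p Y≈q) (sym (evalC-mulQ p q))

  IsPolyC-neg : ∀ {X} → IsPolyC X → IsPolyC (- X)
  IsPolyC-neg (p , X≈p) = scaleQ (ℚ.- 1ℚ) p , trans (-‿cong X≈p) (sym (evalC-neg p))

  IsPolyC-powL : ∀ k → IsPolyC (powL C k)
  IsPolyC-powL k = monomialQ k , sym (evalC-monomialQ k)

  ConstantTermNonzero : List ℚ → Set
  ConstantTermNonzero []      = ⊥
  ConstantTermNonzero (a ∷ _) = a ≢ 0ℚ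

  -- The normal form Cᵏ · u(C) with u(0) ≠ 0 of a nonzero polynomial in C; it makes nonzeroness
  -- visibly closed under products.
  IsNonzeroPolyC : Laurent → Set
  IsNonzeroPolyC X = Σ ℕ λ k → Σ (List ℚ) λ u → ConstantTermNonzero u × (X ≈ powL C k * evalC u)

  IsNonzeroPolyC-resp : ∀ {X Y} → X ≈ Y → IsNonzeroPolyC X → IsNonzeroPolyC Y
  IsNonzeroPolyC-resp X≈Y (k , u , u₀≢0 , X≈u) = k , u , u₀≢0 , trans (sym X≈Y) X≈u

  IsNonzeroPolyC-powL : ∀ k → IsNonzeroPolyC (powL C k)
  IsNonzeroPolyC-powL k = k , 1ℚ ∷ [] , ℚ.1≢0 , sym (trans (*-congˡ (powL C k) evalC-1) (*-identityʳ (powL C k)))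

  IsNonzeroPolyC-1 : IsNonzeroPolyC 1L
  IsNonzeroPolyC-1 = IsNonzeroPolyC-powL 0

  constantTerm-mulQ : ∀ u v → ConstantTermNonzero u → ConstantTermNonzero v → ConstantTermNonzero (mulQ u v)
  constantTerm-mulQ (a ∷ u) (b ∷ v) a≢0 b≢0 ab+0≡0 =
    *-≢0 a≢0 b≢0 (≡.trans (≡.sym (ℚ.+-identityʳ (a ℚ.* b))) ab+0≡0)

  IsNonzeroPolyC-* : ∀ {X Y} → IsNonzeroPolyC X → IsNonzeroPolyC Y → IsNonzeroPolyC (X * Y)
  IsNonzeroPolyC-* {X} {Y} (k , u , u₀≢0 , X≈u) (l , v , v₀≢0 , Y≈v) =
    k ℕ.+ l , mulQ u v , constantTerm-mulQ u v u₀≢0 v₀≢0 , (begin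
    X * Y                                         ≈⟨ *-cong X≈u Y≈v ⟩
    (powL C k * evalC u) * (powL C l * evalC v)   ≈⟨ solve 4 (λ a b c d → (a :* b) :* (c :* d) := (a :* c) :* (b :* d)) refl (powL C k) (evalC u) (powL C l) (evalC v) ⟩
    (powL C k * powL C l) * (evalC u * evalC v)   ≈⟨ *-cong (sym (powL-+ C k l)) (sym (evalC-mulQ u v)) ⟩
    powL C (k ℕ.+ l) * evalC (mulQ u v)           ∎)

  IsNonzeroPolyC-evalC : ∀ D → NonzeroPoly D → IsNonzeroPolyC (evalC D)
  IsNonzeroPolyC-evalC (d ∷ D) (here d≢0) = 0 , d ∷ D , d≢0 , sym (*-identityˡ _)
  IsNonzeroPolyC-evalC (d ∷ D) (there D≢0) with d ℚ.≟ 0ℚ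
  ... | no d≢0  = 0 , d ∷ D , d≢0 , sym (*-identityˡ _)
  ... | yes ≡.refl with IsNonzeroPolyC-evalC D D≢0
  ... | k , u , u₀≢0 , D≈u = suc k , u , u₀≢0 ,
        trans (+-identityˡ _) (trans (*-congˡ C D≈u) (sym (*-assoc C (powL C k) (evalC u))))

  IsNonzeroPolyC⇒NonzeroPoly : ∀ {X} → IsNonzeroPolyC X → Σ (List ℚ) λ D → NonzeroPoly D × (X ≈ evalC D)
  IsNonzeroPolyC⇒NonzeroPoly (k , u , u₀≢0 , X≈u) =
    replicate k 0ℚ ++ u , nonzero k u u₀≢0 , trans X≈u (sym (evalC-zeros k u))
    where
    nonzero : ∀ k u → ConstantTermNonzero u → NonzeroPoly (replicate k 0ℚ ++ u)
    nonzero zero    (a ∷ u) a≢0 = here a≢0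
    nonzero (suc k) u       u₀≢0 = there (nonzero k u u₀≢0)

  IsNonzeroPolyC-neg : ∀ {X} → IsNonzeroPolyC X → IsNonzeroPolyC (- X)
  IsNonzeroPolyC-neg {X} (k , a ∷ u , a≢0 , X≈u) =
    k , scaleQ (ℚ.- 1ℚ) (a ∷ u) , *-≢0 {ℚ.- 1ℚ} (λ ()) a≢0 , (begin
    - X                                         ≈⟨ -‿cong X≈u ⟩
    - (powL C k * evalC (a ∷ u))                ≈⟨ solve 2 (λ c u → :- (c :* u) := c :* (:- u)) refl (powL C k) (evalC (a ∷ u)) ⟩
    powL C k * - evalC (a ∷ u)                  ≈⟨ *-congˡ (powL C k) (evalC-neg (a ∷ u)) ⟨
    powL C k * evalC (scaleQ (ℚ.- 1ℚ) (a ∷ u))  ∎)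

  C^-C^suc-nonzero : ∀ x d → IsNonzeroPolyC (powL C x - powL C (suc (x ℕ.+ d)))
  C^-C^suc-nonzero x d = x , 1ℚ ∷ scaleQ (ℚ.- 1ℚ) (monomialQ d) , ℚ.1≢0 , (begin
    powL C x - C * powL C (x ℕ.+ d)        ≈⟨ +-congˡ (powL C x) (-‿cong (*-congˡ C (powL-+ C x d))) ⟩
    powL C x - C * (powL C x * powL C d)   ≈⟨ solve 3 (λ p c q → p :- c :* (p :* q) := p :* (:1 :+ c :* (:- q))) refl (powL C x) C (powL C d) ⟩
    powL C x * (1L + C * - powL C d)       ≈⟨ *-congˡ (powL C x) (+-congˡ 1L (*-congˡ C (trans (-‿cong (sym (evalC-monomialQ d))) (sym (evalC-neg (monomialQ d)))))) ⟩
    powL C x * evalC (1ℚ ∷ scaleQ (ℚ.- 1ℚ) (monomialQ d)) ∎)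
    where :1 = con (+ 1)

  C^-C^-nonzero-< : ∀ {x y} → x ℕ.< y → IsNonzeroPolyC (powL C x - powL C y)
  C^-C^-nonzero-< {x} x<y with ℕ.m≤n⇒∃[o]m+o≡n x<y
  ... | d , ≡.refl = C^-C^suc-nonzero x d

  C^-C^-nonzero : ∀ {x y} → x ≢ y → IsNonzeroPolyC (powL C x - powL C y)
  C^-C^-nonzero {x} {y} x≢y with ℕ.<-cmp x y
  ... | tri< x<y _ _ = C^-C^-nonzero-< x<y
  ... | tri≈ _ x≡y _ = ⊥-elim (x≢y x≡y)
  ... | tri> _ _ y<x = IsNonzeroPolyC-resp (solve 2 (λ p q → :- (q :- p) := p :- q) refl (powL C x) (powL C y))
                                           (IsNonzeroPolyC-neg (C^-C^-nonzero-< y<x))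

  C-cancelˡ : ∀ X → C * X ≈ 0L → X ≈ 0L
  C-cancelˡ ⟨ k , f ⟩ CX≈0 = λ e → ≡.trans (atℤ-zero f≡0 (e ℤ.+ + k)) (≡.sym (coeffL-0 e))
    where
    CX≡0 : ∀ n → mul Cser f n ≡ 0ℚ
    CX≡0 = ⟨⟩-injective (≈-trans (≈-sym (*L-mul 0 Cser k f)) (≈-trans CX≈0 λ e → ≡.trans (coeffL-0 e) (≡.sym (atℤ-zero (λ _ → ≡.refl) (e ℤ.+ + k)))))
    -- C = x · u with u(0) = 1, so the Cauchy product with C shifts and then multiplies by a unit.
    f·C/x≡0 : ∀ n → mul f (Cser ∘ suc) n ≡ 0ℚ
    f·C/x≡0 n = ≡.trans (mul-comm f (Cser ∘ suc) n)
                  (≡.trans (≡.sym (≡.trans (≡.cong (ℚ._+ mul (Cser ∘ suc) f n) (ℚ.*-zeroˡ (f (suc n)))) (ℚ.+-identityˡ _))) (CX≡0 (suc n)))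
    f≡0 : ∀ n → f n ≡ 0ℚ
    f≡0 = mul-cancel f (Cser ∘ suc) ≡.refl f·C/x≡0

  C^-cancelˡ : ∀ k X → powL C k * X ≈ 0L → X ≈ 0L
  C^-cancelˡ zero    X 1X≈0  = trans (sym (*-identityˡ X)) 1X≈0
  C^-cancelˡ (suc k) X CᵏX≈0 = C^-cancelˡ k X (C-cancelˡ (powL C k * X) (trans (sym (*-assoc C (powL C k) X)) CᵏX≈0))

  product-negC^-cancelˡ : ∀ {m} (a : Fin m → ℕ) X → product (λ i → - powL C (a i)) * X ≈ 0L → X ≈ 0L
  product-negC^-cancelˡ {zero}  a X 1X≈0 = trans (sym (*-identityˡ X)) 1X≈0
  product-negC^-cancelˡ {suc m} a X ΠX≈0 = product-negC^-cancelˡ (a ∘ suc) X (C^-cancelˡ (a zero) (Π * X) (begin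
    powL C (a zero) * (Π * X)        ≈⟨ solve 3 (λ c p x → c :* (p :* x) := :- (:- c :* p :* x)) refl (powL C (a zero)) Π X ⟩
    - (- powL C (a zero) * Π * X)    ≈⟨ -‿cong ΠX≈0 ⟩
    - 0L                             ≈⟨ -0#≈0# ⟩
    0L                               ∎))
    where Π = product (λ i → - powL C (a (suc i)))

  product-negC^-nonzero : ∀ {m} (a : Fin m → ℕ) → ¬ (product (λ i → - powL C (a i)) ≈ 0L)
  product-negC^-nonzero a Π≈0 = ℚ.1≢0 (product-negC^-cancelˡ a 1L (trans (*-identityʳ _) Π≈0) (+ 0))

  IsPolyC-product : ∀ {m} (f : Fin m → Laurent) → (∀ i → IsPolyC (f i)) → IsPolyC (product f)
  IsPolyC-product {zero}  f f-poly = IsPolyC-1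
  IsPolyC-product {suc m} f f-poly = IsPolyC-* (f-poly zero) (IsPolyC-product (f ∘ suc) (f-poly ∘ suc))

  IsPolyC-sum : ∀ {m} (f : Fin m → Laurent) → (∀ i → IsPolyC (f i)) → IsPolyC (sum f)
  IsPolyC-sum {zero}  f f-poly = IsPolyC-0
  IsPolyC-sum {suc m} f f-poly = IsPolyC-+ (f-poly zero) (IsPolyC-sum (f ∘ suc) (f-poly ∘ suc))

  IsNonzeroPolyC-product : ∀ {m} (f : Fin m → Laurent) → (∀ i → IsNonzeroPolyC (f i)) → IsNonzeroPolyC (product f)
  IsNonzeroPolyC-product {zero}  f f≢0 = IsNonzeroPolyC-1
  IsNonzeroPolyC-product {suc m} f f≢0 = IsNonzeroPolyC-* (f≢0 zero) (IsNonzeroPolyC-product (f ∘ suc) (f≢0 ∘ suc))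

  IsPolyC-commonDenominator : ∀ {m} (d x : Fin m → Laurent) → (∀ i → IsPolyC (d i)) → (∀ i → IsPolyC (d i * x i)) →
                              ∀ i → IsPolyC (product d * x i)
  IsPolyC-commonDenominator d x d-poly dx-poly zero = IsPolyC-resp
    (solve 3 (λ d′ d x → d′ :* (d :* x) := (d :* d′) :* x) refl (product (d ∘ suc)) (d zero) (x zero))
    (IsPolyC-* (IsPolyC-product (d ∘ suc) (d-poly ∘ suc)) (dx-poly zero))
  IsPolyC-commonDenominator d x d-poly dx-poly (suc i) = IsPolyC-resp (sym (*-assoc (d zero) (product (d ∘ suc)) (x (suc i))))
    (IsPolyC-* (d-poly zero) (IsPolyC-commonDenominator (d ∘ suc) (x ∘ suc) (d-poly ∘ suc) (dx-poly ∘ suc) i))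

  IsRatC-intro : ∀ {D Q} → IsNonzeroPolyC D → IsPolyC (D * Q) → IsRatC Q
  IsRatC-intro {D} {Q} D≢0 (P , DQ≈P) with IsNonzeroPolyC⇒NonzeroPoly D≢0
  ... | Dl , Dl≢0 , D≈Dl = P , Dl , Dl≢0 , (begin
    Q * evalC Dl  ≈⟨ *-congˡ Q (sym D≈Dl) ⟩
    Q * D         ≈⟨ *-comm Q D ⟩
    D * Q         ≈⟨ DQ≈P ⟩
    evalC P       ∎)

module PolynomialsInZ where

  open LaurentSeries using (+-*-commutativeRing; +-congˡ; +-congʳ; *-congˡ; *-congʳ)
  open CommutativeRing +-*-commutativeRing hiding (_≈_; zero; +-congˡ; +-congʳ; *-congˡ; *-congʳ)
  open import Algebra.Properties.CommutativeMonoid.Sum *-commutativeMonoid using () renaming (sum to product)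
  open IntegerCoefficientSolver +-*-commutativeRing
  open PartialFractions +-*-commutativeRing using (eval; denominator)
  open import Relation.Binary.Reasoning.Setoid setoid
  open import Data.Nat as ℕ using (ℕ; zero; suc; s≤s)
  import Data.Nat.Properties as ℕ
  open import Data.Integer using (+_)
  open import Data.Fin using (Fin; zero; suc)
  open import Data.List using ([]; _∷_)
  open import Data.Vec using (Vec; []; _∷_; toList; last)
  open import Data.Product using (_×_; _,_; proj₁; proj₂)
  import Relation.Binary.PropositionalEquality as ≡
  open import Function using (_∘_)

  linearFactor : Laurent → ZPoly
  linearFactor a = 1L ∷ - a ∷ []

  evalZ-addZ : ∀ p q z → evalZ (addZ p q) z ≈ evalZ p z + evalZ q z
  evalZ-addZ []      q       z = sym (+-identityˡ (evalZ q z))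
  evalZ-addZ (a ∷ p) []      z = sym (+-identityʳ (evalZ (a ∷ p) z))
  evalZ-addZ (a ∷ p) (b ∷ q) z = trans (+-congˡ (a + b) (*-congˡ z (evalZ-addZ p q z)))
    (solve 5 (λ a b z x y → (a :+ b) :+ z :* (x :+ y) := (a :+ z :* x) :+ (b :+ z :* y)) refl a b z (evalZ p z) (evalZ q z))

  evalZ-scaleZ : ∀ a q z → evalZ (scaleZ a q) z ≈ a * evalZ q z
  evalZ-scaleZ a []      z = sym (zeroʳ a)
  evalZ-scaleZ a (b ∷ q) z = trans (+-congˡ (a * b) (*-congˡ z (evalZ-scaleZ a q z)))
    (solve 4 (λ a b z x → a :* b :+ z :* (a :* x) := a :* (b :+ z :* x)) refl a b z (evalZ q z))

  evalZ-mulZ : ∀ p q z → evalZ (mulZ p q) z ≈ evalZ p z * evalZ q z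
  evalZ-mulZ []      q z = sym (zeroˡ (evalZ q z))
  evalZ-mulZ (a ∷ p) q z = begin
    evalZ (addZ (scaleZ a q) (0L ∷ mulZ p q)) z              ≈⟨ evalZ-addZ (scaleZ a q) (0L ∷ mulZ p q) z ⟩
    evalZ (scaleZ a q) z + (0L + z * evalZ (mulZ p q) z)    ≈⟨ +-cong (evalZ-scaleZ a q z) (+-congˡ 0L (*-congˡ z (evalZ-mulZ p q z))) ⟩
    a * evalZ q z + (0L + z * (evalZ p z * evalZ q z))      ≈⟨ solve 4 (λ a y z x → a :* y :+ (con (+ 0) :+ z :* (x :* y))
                                                                        := (a :+ z :* x) :* y) refl a (evalZ q z) z (evalZ p z) ⟩
    (a + z * evalZ p z) * evalZ q z                         ∎

  evalZ-prodFin : ∀ m (A : Fin m → Laurent) z → evalZ (prodFin m (linearFactor ∘ A)) z ≈ denominator A z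
  evalZ-prodFin zero    A z = solve 1 (λ z → con (+ 1) :+ z :* con (+ 0) := con (+ 1)) refl z
  evalZ-prodFin (suc m) A z = trans (evalZ-mulZ (linearFactor (A zero)) (prodFin m (linearFactor ∘ A ∘ suc)) z)
    (*-cong (solve 2 (λ a z → con (+ 1) :+ z :* (:- a :+ z :* con (+ 0)) := con (+ 1) :- z :* a) refl (A zero) z)
            (evalZ-prodFin m (A ∘ suc) z))

  evalZ-toList : ∀ {n} (v : Vec Laurent n) z → evalZ (toList v) z ≡.≡ eval v z
  evalZ-toList []      z = ≡.refl
  evalZ-toList (x ∷ v) z = ≡.cong (λ y → x + z * y) (evalZ-toList v z)

  coeffZ-toList : ∀ {n} (v : Vec Laurent (suc n)) → coeffZ (toList v) n ≡.≡ last v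
  coeffZ-toList (x ∷ [])     = ≡.refl
  coeffZ-toList (x ∷ y ∷ v) = coeffZ-toList (y ∷ v)

  coeffZ-[] : ∀ j → coeffZ [] j ≈ 0L
  coeffZ-[] zero    = refl
  coeffZ-[] (suc j) = refl

  coeffZ-addZ : ∀ p q j → coeffZ (addZ p q) j ≈ coeffZ p j + coeffZ q j
  coeffZ-addZ []      q       j       = sym (trans (+-congʳ (coeffZ q j) (coeffZ-[] j)) (+-identityˡ (coeffZ q j)))
  coeffZ-addZ (a ∷ p) []      j       = sym (trans (+-congˡ (coeffZ (a ∷ p) j) (coeffZ-[] j)) (+-identityʳ (coeffZ (a ∷ p) j)))
  coeffZ-addZ (a ∷ p) (b ∷ q) zero    = refl
  coeffZ-addZ (a ∷ p) (b ∷ q) (suc j) = coeffZ-addZ p q j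

  coeffZ-scaleZ : ∀ a q j → coeffZ (scaleZ a q) j ≈ a * coeffZ q j
  coeffZ-scaleZ a []      j       = trans (coeffZ-[] j) (sym (trans (*-congˡ a (coeffZ-[] j)) (zeroʳ a)))
  coeffZ-scaleZ a (b ∷ q) zero    = refl
  coeffZ-scaleZ a (b ∷ q) (suc j) = coeffZ-scaleZ a q j

  coeffZ-linearFactor : ∀ a q j → coeffZ (mulZ (linearFactor a) q) (suc j) ≈ coeffZ q (suc j) - a * coeffZ q j
  coeffZ-linearFactor a q j = begin
    coeffZ (addZ (scaleZ 1L q) (0L ∷ mulZ (- a ∷ []) q)) (suc j)
      ≈⟨ coeffZ-addZ (scaleZ 1L q) (0L ∷ mulZ (- a ∷ []) q) (suc j) ⟩
    coeffZ (scaleZ 1L q) (suc j) + coeffZ (addZ (scaleZ (- a) q) (0L ∷ [])) j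
      ≈⟨ +-cong (coeffZ-scaleZ 1L q (suc j)) (coeffZ-addZ (scaleZ (- a) q) (0L ∷ []) j) ⟩
    1L * coeffZ q (suc j) + (coeffZ (scaleZ (- a) q) j + coeffZ (0L ∷ []) j)
      ≈⟨ +-cong (*-identityˡ (coeffZ q (suc j))) (+-cong (coeffZ-scaleZ (- a) q j) (coeffZ-0 j)) ⟩
    coeffZ q (suc j) + (- a * coeffZ q j + 0L)
      ≈⟨ solve 3 (λ x a y → x :+ (:- a :* y :+ con (+ 0)) := x :- a :* y) refl (coeffZ q (suc j)) a (coeffZ q j) ⟩
    coeffZ q (suc j) - a * coeffZ q j ∎
    where
    coeffZ-0 : ∀ j → coeffZ (0L ∷ []) j ≈ 0L
    coeffZ-0 zero    = refl
    coeffZ-0 (suc j) = coeffZ-[] j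

  prodFin-degree : ∀ m (A : Fin m → Laurent) →
    (∀ j → m ℕ.< j → coeffZ (prodFin m (linearFactor ∘ A)) j ≈ 0L) × (coeffZ (prodFin m (linearFactor ∘ A)) m ≈ product (λ i → - A i))
  prodFin-degree zero    A = (λ { (suc zero) _ → refl ; (suc (suc j)) _ → refl }) , refl
  prodFin-degree (suc m) A = above , top
    where
    q = prodFin m (linearFactor ∘ A ∘ suc)
    IH = prodFin-degree m (A ∘ suc)
    above : ∀ j → suc m ℕ.< j → coeffZ (prodFin (suc m) (linearFactor ∘ A)) j ≈ 0L
    above (suc j) (s≤s m<j) = begin
      coeffZ (mulZ (linearFactor (A zero)) q) (suc j)   ≈⟨ coeffZ-linearFactor (A zero) q j ⟩
      coeffZ q (suc j) - A zero * coeffZ q j            ≈⟨ +-cong (proj₁ IH (suc j) (ℕ.m<n⇒m<1+n m<j)) (-‿cong (*-congˡ (A zero) (proj₁ IH j m<j))) ⟩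
      0L - A zero * 0L                                  ≈⟨ solve 1 (λ a → con (+ 0) :- a :* con (+ 0) := con (+ 0)) refl (A zero) ⟩
      0L                                                ∎
    top : coeffZ (prodFin (suc m) (linearFactor ∘ A)) (suc m) ≈ product (λ i → - A i)
    top = begin
      coeffZ (mulZ (linearFactor (A zero)) q) (suc m)   ≈⟨ coeffZ-linearFactor (A zero) q m ⟩
      coeffZ q (suc m) - A zero * coeffZ q m            ≈⟨ +-cong (proj₁ IH (suc m) (ℕ.n<1+n m)) (-‿cong (*-congˡ (A zero) (proj₂ IH))) ⟩
      0L - A zero * product (λ i → - A (suc i))         ≈⟨ solve 2 (λ a p → con (+ 0) :- a :* p := :- a :* p) refl (A zero) (product (λ i → - A (suc i))) ⟩
      - A zero * product (λ i → - A (suc i))            ∎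

module Valuation where

  open PowerSeries using (mul; mul-vanishes)
  open LaurentSeries using (+-*-commutativeRing; coeffL-+; coeffL-0; *L-mul; ≈-sym)
  open CommutativeRing +-*-commutativeRing using (_+_; _*_; *-commutativeMonoid)
  open import Algebra.Properties.CommutativeMonoid.Sum *-commutativeMonoid using () renaming (sum to product)
  open PartialFractions +-*-commutativeRing using (eval)
  open import Data.Vec using (Vec; []; _∷_)
  open import Data.Fin using (Fin; zero; suc)
  open import Data.Nat as ℕ using (ℕ; zero; suc)
  import Data.Nat.Properties as ℕ
  open import Data.Integer as ℤ using (ℤ; +_; -[1+_]; +<+; +≤+)
  import Data.Integer.Properties as ℤ
  open import Data.Integer.Solver using (module +-*-Solver)
  open +-*-Solver using (solve; _:=_; _:+_; _:-_)
  open import Data.Rational as ℚ using (0ℚ)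
  import Data.Rational.Properties as ℚ
  open import Data.Sum using (_⊎_; inj₁; inj₂)
  open import Data.Empty using (⊥-elim)
  open import Relation.Nullary using (yes; no)
  open import Relation.Binary.PropositionalEquality
  open ≡-Reasoning
  open import Function using (_∘_)

  OrderAtLeast : Laurent → ℤ → Set
  OrderAtLeast A b = ∀ e → e ℤ.< b → coeffL A e ≡ 0ℚ

  OrderAtLeast-resp : ∀ {A B b} → A ≈ B → OrderAtLeast A b → OrderAtLeast B b
  OrderAtLeast-resp A≈B A=O e e<b = trans (sym (A≈B e)) (A=O e e<b)

  OrderAtLeast-mono : ∀ {A b b′} → b′ ℤ.≤ b → OrderAtLeast A b → OrderAtLeast A b′
  OrderAtLeast-mono b′≤b A=O e e<b′ = A=O e (ℤ.<-≤-trans e<b′ b′≤b)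

  OrderAtLeast-0 : ∀ b → OrderAtLeast 0L b
  OrderAtLeast-0 b e _ = coeffL-0 e

  OrderAtLeast-+ : ∀ {A B b} → OrderAtLeast A b → OrderAtLeast B b → OrderAtLeast (A + B) b
  OrderAtLeast-+ {A} {B} A=O B=O e e<b =
    trans (coeffL-+ A B e) (trans (cong₂ ℚ._+_ (A=O e e<b) (B=O e e<b)) (ℚ.+-identityˡ 0ℚ))

  OrderAtLeast-ord : ∀ A → OrderAtLeast A (ℤ.- + ord A)
  OrderAtLeast-ord ⟨ k , f ⟩ e e<-k with e ℤ.+ + k in eq
  ... | -[1+ n ] = refl
  ... | + n with ℤ.drop‿+<+ (subst₂ ℤ._<_ eq (ℤ.+-inverseˡ (+ k)) (ℤ.+-monoˡ-< (+ k) e<-k))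
  ...   | ()

  OrderAtLeast⇒vanishes : ∀ {k f b} → OrderAtLeast ⟨ k , f ⟩ b → ∀ i → + i ℤ.< b ℤ.+ + k → f i ≡ 0ℚ
  OrderAtLeast⇒vanishes {k} {f} {b} A=O i i<b+k = subst (λ x → atℤ f x ≡ 0ℚ) i-k+k≡i (A=O (+ i ℤ.- + k) i-k<b)
    where
    i-k+k≡i : + i ℤ.- + k ℤ.+ + k ≡ + i
    i-k+k≡i = solve 2 (λ i k → i :- k :+ k := i) refl (+ i) (+ k)
    i-k<b : + i ℤ.- + k ℤ.< b
    i-k<b = subst (+ i ℤ.- + k ℤ.<_) (solve 2 (λ b k → b :+ k :- k := b) refl b (+ k)) (ℤ.+-monoˡ-< (ℤ.- + k) i<b+k)

  vanishes⇒OrderAtLeast : ∀ k f b → (∀ i → + i ℤ.< b ℤ.+ + k → f i ≡ 0ℚ) → OrderAtLeast ⟨ k , f ⟩ b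
  vanishes⇒OrderAtLeast k f b f≡0 e e<b with e ℤ.+ + k in eq
  ... | + n      = f≡0 n (subst (ℤ._< b ℤ.+ + k) eq (ℤ.+-monoˡ-< (+ k) e<b))
  ... | -[1+ n ] = refl

  -- A coefficient x ^ n of the product comes from pairs i + j = n, and one of x ^ i, x ^ j lies below the bound.
  OrderAtLeast-* : ∀ {A B b₁ b₂} → OrderAtLeast A b₁ → OrderAtLeast B b₂ → OrderAtLeast (A * B) (b₁ ℤ.+ b₂)
  OrderAtLeast-* {⟨ k , f ⟩} {⟨ l , g ⟩} {b₁} {b₂} A=O B=O =
    OrderAtLeast-resp (≈-sym (*L-mul k f l g)) (vanishes⇒OrderAtLeast (k ℕ.+ l) (mul f g) (b₁ ℤ.+ b₂) fg≡0)
    where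
    regroup : b₁ ℤ.+ b₂ ℤ.+ + (k ℕ.+ l) ≡ (b₁ ℤ.+ + k) ℤ.+ (b₂ ℤ.+ + l)
    regroup = trans (cong (λ x → b₁ ℤ.+ b₂ ℤ.+ x) (ℤ.pos-+ k l))
                    (solve 4 (λ a b c d → a :+ b :+ (c :+ d) := (a :+ c) :+ (b :+ d)) refl b₁ b₂ (+ k) (+ l))
    fg≡0 : ∀ n → + n ℤ.< b₁ ℤ.+ b₂ ℤ.+ + (k ℕ.+ l) → mul f g n ≡ 0ℚ
    fg≡0 n n<b = mul-vanishes n f g split
      where
      split : ∀ i j → i ℕ.+ j ≡ n → f i ≡ 0ℚ ⊎ g j ≡ 0ℚ
      split i j i+j≡n with + i ℤ.<? b₁ ℤ.+ + k | + j ℤ.<? b₂ ℤ.+ + l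
      ... | yes i< | _      = inj₁ (OrderAtLeast⇒vanishes A=O i i<)
      ... | no _   | yes j< = inj₂ (OrderAtLeast⇒vanishes B=O j j<)
      ... | no i≮  | no j≮  = ⊥-elim (ℤ.<⇒≱ (subst (+ n ℤ.<_) regroup n<b) n≥)
        where
        n≥ : (b₁ ℤ.+ + k) ℤ.+ (b₂ ℤ.+ + l) ℤ.≤ + n
        n≥ = subst ((b₁ ℤ.+ + k) ℤ.+ (b₂ ℤ.+ + l) ℤ.≤_) (trans (sym (ℤ.pos-+ i j)) (cong +_ i+j≡n)) (ℤ.+-mono-≤ (ℤ.≮⇒≥ i≮) (ℤ.≮⇒≥ j≮))

  OrderAtLeast-1 : OrderAtLeast 1L (+ 0)
  OrderAtLeast-1 = vanishes⇒OrderAtLeast 0 (ser 1L) (+ 0) λ { i (+<+ ()) }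

  OrderAtLeast-C : OrderAtLeast C (+ 1)
  OrderAtLeast-C = vanishes⇒OrderAtLeast 0 Cser (+ 1) λ { zero _ → refl ; (suc i) (+<+ (ℕ.s≤s ())) }

  OrderAtLeast-C^ : ∀ n → OrderAtLeast (powL C n) (+ n)
  OrderAtLeast-C^ zero    = OrderAtLeast-1
  OrderAtLeast-C^ (suc n) = OrderAtLeast-* {C} {powL C n} OrderAtLeast-C (OrderAtLeast-C^ n)

  -- Order is inherited along X = Y + X Z with Z = O(x): each coefficient of X is one of Y plus earlier ones of X.
  OrderAtLeast-fixpoint : ∀ X Y Z b → X ≈ Y + X * Z → OrderAtLeast Y b → OrderAtLeast Z (+ 1) → OrderAtLeast X b
  OrderAtLeast-fixpoint X Y Z b X≈Y+XZ Y=O Z=O e e<b = below (suc ℤ.∣ e ℤ.+ + ord X ∣) e e<b (<suc∣∣ (e ℤ.+ + ord X))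
    where
    <suc∣∣ : ∀ i → i ℤ.< + suc ℤ.∣ i ∣
    <suc∣∣ (+ n)    = +<+ (ℕ.n<1+n n)
    <suc∣∣ -[1+ n ] = ℤ.-<+
    below : ∀ d e → e ℤ.< b → e ℤ.+ + ord X ℤ.< + d → coeffL X e ≡ 0ℚ
    below zero    e _   e+k<0 = OrderAtLeast-ord X e
      (subst₂ ℤ._<_ (solve 2 (λ e k → e :+ k :- k := e) refl e (+ ord X)) (ℤ.+-identityˡ _) (ℤ.+-monoˡ-< (ℤ.- + ord X) e+k<0))
    below (suc d) e e<b e+k<1+d = begin
      coeffL X e                          ≡⟨ X≈Y+XZ e ⟩
      coeffL (Y + X * Z) e                ≡⟨ coeffL-+ Y (X * Z) e ⟩
      coeffL Y e ℚ.+ coeffL (X * Z) e     ≡⟨ cong₂ ℚ._+_ (Y=O e e<b) (OrderAtLeast-* {X} {Z} X=O Z=O e e<e+1) ⟩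
      0ℚ ℚ.+ 0ℚ                           ≡⟨ ℚ.+-identityˡ 0ℚ ⟩
      0ℚ                                  ∎
      where
      e<e+1 : e ℤ.< e ℤ.+ + 1
      e<e+1 = subst (e ℤ.<_) (ℤ.+-comm (+ 1) e) (ℤ.suc[i]≤j⇒i<j ℤ.≤-refl)
      X=O : OrderAtLeast X e
      X=O e′ e′<e = below d e′ (ℤ.<-trans e′<e e<b) (ℤ.<-≤-trans (ℤ.+-monoˡ-< (+ ord X) e′<e) (ℤ.i<j⇒i≤pred[j] e+k<1+d))

  orderBound : ∀ {n} → Vec Laurent n → ℕ
  orderBound []      = 0
  orderBound (x ∷ v) = ord x ℕ.+ orderBound v

  OrderAtLeast-eval : ∀ {n} (v : Vec Laurent n) z → OrderAtLeast z (+ 0) → OrderAtLeast (eval v z) (ℤ.- + orderBound v)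
  OrderAtLeast-eval []      z z=O = OrderAtLeast-0 _
  OrderAtLeast-eval (x ∷ v) z z=O = OrderAtLeast-+ {x} {z * eval v z}
    (OrderAtLeast-mono (ℤ.neg-mono-≤ (+≤+ (ℕ.m≤m+n (ord x) (orderBound v)))) (OrderAtLeast-ord x))
    (OrderAtLeast-mono (subst (ℤ.- + (ord x ℕ.+ orderBound v) ℤ.≤_) (sym (ℤ.+-identityˡ (ℤ.- + orderBound v))) (ℤ.neg-mono-≤ (+≤+ (ℕ.m≤n+m (orderBound v) (ord x)))))
       (OrderAtLeast-* {z} {eval v z} z=O (OrderAtLeast-eval v z z=O)))

  OrderAtLeast-product : ∀ {m} (f : Fin m → Laurent) → (∀ i → OrderAtLeast (f i) (+ 0)) → OrderAtLeast (product f) (+ 0)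
  OrderAtLeast-product {zero}  f f=O = OrderAtLeast-1
  OrderAtLeast-product {suc m} f f=O = OrderAtLeast-* {f zero} {product (f ∘ suc)} (f=O zero) (OrderAtLeast-product (f ∘ suc) (f=O ∘ suc))

module Summation where

  open Valuation
  open LaurentSeries using (+-*-commutativeRing; coeffL-+; coeffL-neg; +-congʳ; *-congˡ)
  open CommutativeRing +-*-commutativeRing hiding (_≈_; zero; +-congʳ; *-congˡ)
  open import Algebra.Properties.Semiring.Sum semiring using (sum)
  open IntegerCoefficientSolver +-*-commutativeRing
  open import Relation.Binary.Reasoning.Setoid setoid
  open import Data.Nat as ℕ using (ℕ; zero; suc; _≤_; _⊔_)
  import Data.Nat.Properties as ℕ
  open import Data.Integer as ℤ using (ℤ; +_; -[1+_]; +<+; +≤+)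
  import Data.Integer.Properties as ℤ
  import Data.Integer.Solver as ℤSolver
  open import Data.Rational as ℚ using (0ℚ)
  import Data.Rational.Properties as ℚ
  open import Data.Fin using (Fin; zero; suc)
  open import Data.Product using (Σ; _,_)
  import Relation.Binary.PropositionalEquality as ≡
  open ≡ using (_≡_; subst₂)
  open import Function using (_∘_)
  open import Algebra.Properties.Group ℚ.+-0-group using (x∙y⁻¹≈ε⇒x≈y)

  private
    module ℤS = ℤSolver.+-*-Solver

  AgreeBelow : Laurent → Laurent → ℤ → Set
  AgreeBelow X Y b = ∀ e → e ℤ.< b → coeffL X e ≡ coeffL Y e

  AgreeBelow⇒OrderAtLeast : ∀ {X Y b} → AgreeBelow X Y b → OrderAtLeast (X - Y) b
  AgreeBelow⇒OrderAtLeast {X} {Y} X=Y e e<b =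
    ≡.trans (coeffL-+ X (- Y) e) (≡.trans (≡.cong₂ ℚ._+_ (X=Y e e<b) (coeffL-neg Y e)) (ℚ.+-inverseʳ (coeffL Y e)))

  OrderAtLeast⇒AgreeBelow : ∀ {X Y b} → OrderAtLeast (X - Y) b → AgreeBelow X Y b
  OrderAtLeast⇒AgreeBelow {X} {Y} X-Y=O e e<b = x∙y⁻¹≈ε⇒x≈y (coeffL X e) (coeffL Y e)
    (≡.trans (≡.cong (coeffL X e ℚ.+_) (≡.sym (coeffL-neg Y e))) (≡.trans (≡.sym (coeffL-+ X (- Y) e)) (X-Y=O e e<b)))

  partialSum-cong : ∀ {t u} → (∀ n → t n ≈ u n) → ∀ N → partialSum t N ≈ partialSum u N
  partialSum-cong t≈u zero    = refl
  partialSum-cong t≈u (suc N) = +-cong (partialSum-cong t≈u N) (t≈u N)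

  IsSum-cong : ∀ {t u S S′} → (∀ n → t n ≈ u n) → S ≈ S′ → IsSum t S → IsSum u S′
  IsSum-cong {t} {u} t≈u S≈S′ t→S B with t→S B
  ... | M , conv = M , λ N M≤N e e<B →
    ≡.trans (≡.sym (partialSum-cong t≈u N e)) (≡.trans (conv N M≤N e e<B) (S≈S′ e))

  IsSum-unique : ∀ {t S S′} → IsSum t S → IsSum t S′ → S ≈ S′
  IsSum-unique {t} t→S t→S′ e with t→S (+ 1 ℤ.+ e) | t→S′ (+ 1 ℤ.+ e)
  ... | M , conv | M′ , conv′ =
    ≡.trans (≡.sym (conv (M ⊔ M′) (ℕ.m≤m⊔n M M′) e e<1+e)) (conv′ (M ⊔ M′) (ℕ.m≤n⊔m M M′) e e<1+e)
    where e<1+e = ℤ.suc[i]≤j⇒i<j ℤ.≤-refl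

  IsSum-0 : IsSum (λ _ → 0L) 0L
  IsSum-0 B = 0 , λ N _ e _ → partialSum-0 N e
    where
    partialSum-0 : ∀ N → partialSum (λ _ → 0L) N ≈ 0L
    partialSum-0 zero    = refl
    partialSum-0 (suc N) = trans (+-identityʳ _) (partialSum-0 N)

  IsSum-+ : ∀ {t u S U} → IsSum t S → IsSum u U → IsSum (λ n → t n + u n) (S + U)
  IsSum-+ {t} {u} {S} {U} t→S u→U B with t→S B | u→U B
  ... | M , conv | M′ , conv′ = M ⊔ M′ , λ N M⊔M′≤N e e<B →
    ≡.trans (partialSum-+ N e) (≡.trans (coeffL-+ (partialSum t N) (partialSum u N) e)
      (≡.trans (≡.cong₂ ℚ._+_ (conv N (ℕ.m⊔n≤o⇒m≤o M M′ M⊔M′≤N) e e<B) (conv′ N (ℕ.m⊔n≤o⇒n≤o M M′ M⊔M′≤N) e e<B))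
               (≡.sym (coeffL-+ S U e))))
    where
    partialSum-+ : ∀ N → partialSum (λ n → t n + u n) N ≈ partialSum t N + partialSum u N
    partialSum-+ zero    = sym (+-identityˡ 0L)
    partialSum-+ (suc N) = trans (+-congʳ (t N + u N) (partialSum-+ N))
      (solve 4 (λ a b c d → (a :+ b) :+ (c :+ d) := (a :+ c) :+ (b :+ d)) refl (partialSum t N) (partialSum u N) (t N) (u N))

  IsSum-sum : ∀ {m} (t : Fin m → ℕ → Laurent) (S : Fin m → Laurent) → (∀ i → IsSum (t i) (S i)) →
              IsSum (λ n → sum (λ i → t i n)) (sum S)
  IsSum-sum {zero}  t S t→S = IsSum-0
  IsSum-sum {suc m} t S t→S = IsSum-+ (t→S zero) (IsSum-sum (t ∘ suc) (S ∘ suc) (t→S ∘ suc))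

  IsSum-scale : ∀ c {t S} → IsSum t S → IsSum (λ n → c * t n) (c * S)
  IsSum-scale c {t} {S} t→S B with t→S (B ℤ.+ + ord c)
  ... | M , conv = M , λ N M≤N → OrderAtLeast⇒AgreeBelow {partialSum (λ n → c * t n) N} {c * S}
      (OrderAtLeast-resp (difference N) (OrderAtLeast-mono (ℤ.≤-reflexive (bound)) (OrderAtLeast-* {c} (OrderAtLeast-ord c) (AgreeBelow⇒OrderAtLeast (conv N M≤N)))))
    where
    bound : B ≡ ℤ.- + ord c ℤ.+ (B ℤ.+ + ord c)
    bound = ℤS.solve 2 (λ b k → b ℤS.:= ℤS.:- k ℤS.:+ (b ℤS.:+ k)) ≡.refl B (+ ord c)
    partialSum-scale : ∀ N → partialSum (λ n → c * t n) N ≈ c * partialSum t N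
    partialSum-scale zero    = sym (zeroʳ c)
    partialSum-scale (suc N) = trans (+-congʳ (c * t N) (partialSum-scale N)) (sym (distribˡ c (partialSum t N) (t N)))
    difference : ∀ N → c * (partialSum t N - S) ≈ partialSum (λ n → c * t n) N - c * S
    difference N = trans (solve 3 (λ c x s → c :* (x :- s) := c :* x :- c :* s) refl c (partialSum t N) S)
                         (+-congʳ (- (c * S)) (sym (partialSum-scale N)))

  IsSum-drop : ∀ {t S} k → IsSum t S → IsSum (λ n → t (n ℕ.+ k)) (S - partialSum t k)
  IsSum-drop {t} {S} k t→S B with t→S B
  ... | M , conv = M , λ N M≤N → OrderAtLeast⇒AgreeBelow {partialSum (λ n → t (n ℕ.+ k)) N} {S - partialSum t k}
      (OrderAtLeast-resp (difference N) (AgreeBelow⇒OrderAtLeast (conv (N ℕ.+ k) (ℕ.≤-trans M≤N (ℕ.m≤m+n N k)))))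
    where
    partialSum-split : ∀ N → partialSum t (N ℕ.+ k) ≈ partialSum t k + partialSum (λ n → t (n ℕ.+ k)) N
    partialSum-split zero    = sym (+-identityʳ (partialSum t k))
    partialSum-split (suc N) = trans (+-congʳ (t (N ℕ.+ k)) (partialSum-split N))
                                     (+-assoc (partialSum t k) (partialSum (λ n → t (n ℕ.+ k)) N) (t (N ℕ.+ k)))
    difference : ∀ N → partialSum t (N ℕ.+ k) - S ≈ partialSum (λ n → t (n ℕ.+ k)) N - (S - partialSum t k)
    difference N = trans (+-congʳ (- S) (partialSum-split N))
      (solve 3 (λ a b s → (a :+ b) :- s := b :- (s :- a)) refl (partialSum t k) (partialSum (λ n → t (n ℕ.+ k)) N) S)

  OrderAtLeast-partialSum : ∀ {t b} → (∀ n → OrderAtLeast (t n) b) → ∀ N → OrderAtLeast (partialSum t N) b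
  OrderAtLeast-partialSum {b = b} t=O zero    = OrderAtLeast-0 b
  OrderAtLeast-partialSum {t}     t=O (suc N) = OrderAtLeast-+ {partialSum t N} {t N} (OrderAtLeast-partialSum t=O N) (t=O N)

  partialSum-stable : ∀ t e {M N} → (∀ n → M ≤ n → coeffL (t n) e ≡ 0ℚ) → M ℕ.≤′ N →
                      coeffL (partialSum t N) e ≡ coeffL (partialSum t M) e
  partialSum-stable t e t≡0 ℕ.≤′-refl = ≡.refl
  partialSum-stable t e t≡0 (ℕ.≤′-step {N} M≤′N) =
    ≡.trans (coeffL-+ (partialSum t N) (t N) e)
      (≡.trans (≡.cong₂ ℚ._+_ (partialSum-stable t e t≡0 M≤′N) (t≡0 N (ℕ.≤′⇒≤ M≤′N))) (ℚ.+-identityʳ _))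

  -- If t n = O(x ^ (n - K)), the coefficient of x ^ e of the sum is read off the partial sum of the first
  -- e + K + 1 terms; below x ^ -K all partial sums vanish.
  IsSum-exists : ∀ (t : ℕ → Laurent) K → (∀ n → OrderAtLeast (t n) (+ n ℤ.- + K)) → Σ Laurent (IsSum t)
  IsSum-exists t K t=O = ⟨ K , s ⟩ , t→S
    where
    s : PS
    s j = coeffL (partialSum t (suc j)) (+ j ℤ.- + K)
    t→S : IsSum t ⟨ K , s ⟩
    t→S B = ℤ.∣ B ℤ.+ + K ∣ , converged
      where
      converged : ∀ N → ℤ.∣ B ℤ.+ + K ∣ ≤ N → ∀ e → e ℤ.< B → coeffL (partialSum t N) e ≡ coeffL ⟨ K , s ⟩ e
      converged N M≤N e e<B with e ℤ.+ + K in e+K≡j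
      ... | + j = ≡.trans (partialSum-stable t e vanish (ℕ.≤⇒≤′ 1+j≤N)) (≡.cong (coeffL (partialSum t (suc j))) e≡j-K)
        where
        e≡j-K : e ≡ + j ℤ.- + K
        e≡j-K = ≡.trans (ℤS.solve 2 (λ e k → e ℤS.:= e ℤS.:+ k ℤS.:- k) ≡.refl e (+ K)) (≡.cong (ℤ._- + K) e+K≡j)
        ≤∣∣ : ∀ i → i ℤ.≤ + ℤ.∣ i ∣
        ≤∣∣ (+ n)    = ℤ.≤-refl
        ≤∣∣ -[1+ n ] = ℤ.-≤+
        1+j≤N : suc j ≤ N
        1+j≤N = ℕ.≤-trans (ℤ.drop‿+<+ (ℤ.<-≤-trans (subst₂ ℤ._<_ e+K≡j ≡.refl (ℤ.+-monoˡ-< (+ K) e<B)) (≤∣∣ (B ℤ.+ + K)))) M≤N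
        vanish : ∀ n → suc j ≤ n → coeffL (t n) e ≡ 0ℚ
        vanish n 1+j≤n = t=O n e (subst₂ ℤ._<_ (≡.sym e≡j-K) ≡.refl (ℤ.+-monoˡ-< (ℤ.- + K) (+<+ 1+j≤n)))
      ... | -[1+ i ] = OrderAtLeast-partialSum (λ n → OrderAtLeast-mono (n-K≥-K n) (t=O n)) N e e<-K
        where
        n-K≥-K : ∀ n → ℤ.- + K ℤ.≤ + n ℤ.- + K
        n-K≥-K n = ≡.subst (ℤ._≤ + n ℤ.- + K) (ℤ.+-identityˡ (ℤ.- + K)) (ℤ.+-monoˡ-≤ (ℤ.- + K) (+≤+ ℕ.z≤n))
        e<-K : e ℤ.< ℤ.- + K
        e<-K = subst₂ ℤ._<_ (ℤS.solve 2 (λ e k → e ℤS.:+ k ℤS.:- k ℤS.:= e) ≡.refl e (+ K)) (ℤ.+-identityˡ (ℤ.- + K))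
                 (ℤ.+-monoˡ-< (ℤ.- + K) (≡.subst (ℤ._< + 0) (≡.sym e+K≡j) ℤ.-<+))

open import Data.Nat as ℕ using (ℕ; suc; _≤_; z≤n)
import Data.Nat.Properties as ℕ
open import Data.Fin using (Fin)
open import Data.Vec using (Vec; lookup; toList; map; last; _∷_)
open import Data.Vec.Relation.Unary.All using (All; _∷_)
import Data.Vec.Relation.Unary.All.Properties as All
open import Data.List using (List; []; _∷_)
open import Data.Rational using (ℚ)
open import Data.Product using (Σ; _×_; _,_; proj₁; proj₂)
import Relation.Binary.PropositionalEquality as ≡
open ≡ using (_≡_)
open import Function.Definitions using (Injective)
open import Function using (_∘_)
open import Data.Integer as ℤ using (+_; +≤+)
import Data.Integer.Properties as ℤ
open import Data.Empty using (⊥-elim)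
open import Relation.Binary.Definitions using (tri<; tri≈; tri>)

module GeometricTerms (ψ : ℕ → Laurent) (ψ-def : ∀ n → ψ n *L (1L -L powL C (suc n)) ≈ powL C (suc n)) where

  open Valuation
  open PolynomialsInC
  open LaurentSeries using (+-*-commutativeRing; +-congˡ; +-congʳ; *-congˡ; *-congʳ)
  open CommutativeRing +-*-commutativeRing hiding (_≈_; zero; +-congˡ; +-congʳ; *-congˡ; *-congʳ)
  open IntegerCoefficientSolver +-*-commutativeRing
  open import Relation.Binary.Reasoning.Setoid setoid
  open import Data.Nat as ℕ using (ℕ; zero; suc; s≤s; z≤n)
  open import Data.Integer as ℤ using (+_; +≤+)

  1+ψ-inverse : ∀ n → (1L + ψ n) * (1L - powL C (suc n)) ≈ 1L
  1+ψ-inverse n = begin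
    (1L + ψ n) * (1L - X)         ≈⟨ solve 2 (λ p x → (con (+ 1) :+ p) :* (con (+ 1) :- x) := (con (+ 1) :- x) :+ p :* (con (+ 1) :- x)) refl (ψ n) X ⟩
    (1L - X) + ψ n * (1L - X)     ≈⟨ +-congˡ (1L - X) (ψ-def n) ⟩
    (1L - X) + X                  ≈⟨ solve 1 (λ x → (con (+ 1) :- x) :+ x := con (+ 1)) refl X ⟩
    1L                            ∎
    where X = powL C (suc n)

  ψ-order : ∀ n → OrderAtLeast (ψ n) (+ suc n)
  ψ-order n = OrderAtLeast-fixpoint (ψ n) X X (+ suc n) fixpoint (OrderAtLeast-C^ (suc n)) (OrderAtLeast-mono (+≤+ (s≤s z≤n)) (OrderAtLeast-C^ (suc n)))
    where
    X = powL C (suc n)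
    fixpoint : ψ n ≈ X + ψ n * X
    fixpoint = begin
      ψ n                               ≈⟨ solve 2 (λ p x → p := p :* (con (+ 1) :- x) :+ p :* x) refl (ψ n) X ⟩
      ψ n * (1L - X) + ψ n * X          ≈⟨ +-congʳ (ψ n * X) (ψ-def n) ⟩
      X + ψ n * X                       ∎

  OrderAtLeast-1+ψ : ∀ n → OrderAtLeast (1L + ψ n) (+ 0)
  OrderAtLeast-1+ψ n = OrderAtLeast-+ {1L} {ψ n} OrderAtLeast-1 (OrderAtLeast-mono (+≤+ z≤n) (ψ-order n))

  -- (1 - C)(1 - C²)⋯(1 - Cᵏ) clears the denominators of ψ 0, …, ψ (k - 1).
  W : ℕ → Laurent
  W zero    = 1L
  W (suc k) = (1L - powL C (suc k)) * W k

  W-poly : ∀ k → IsPolyC (W k)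
  W-poly zero    = IsPolyC-1
  W-poly (suc k) = IsPolyC-* (IsPolyC-+ IsPolyC-1 (IsPolyC-neg (IsPolyC-powL (suc k)))) (W-poly k)

  W-nonzero : ∀ k → IsNonzeroPolyC (W k)
  W-nonzero zero    = IsNonzeroPolyC-1
  W-nonzero (suc k) = IsNonzeroPolyC-* (C^-C^-nonzero {0} {suc k} (λ ())) (W-nonzero k)

  W*partialSum-poly : ∀ k → IsPolyC (W k * partialSum ψ k)
  W*partialSum-poly zero    = IsPolyC-resp (sym (zeroʳ 1L)) IsPolyC-0
  W*partialSum-poly (suc k) = IsPolyC-resp split
    (IsPolyC-+ (IsPolyC-* (IsPolyC-+ IsPolyC-1 (IsPolyC-neg (IsPolyC-powL (suc k)))) (W*partialSum-poly k))
               (IsPolyC-* (IsPolyC-powL (suc k)) (W-poly k)))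
    where
    X = powL C (suc k)
    split : (1L - X) * (W k * partialSum ψ k) + X * W k ≈ W (suc k) * (partialSum ψ k + ψ k)
    split = begin
      (1L - X) * (W k * partialSum ψ k) + X * W k             ≈⟨ +-congˡ ((1L - X) * (W k * partialSum ψ k)) (*-congʳ (W k) (sym (ψ-def k))) ⟩
      (1L - X) * (W k * partialSum ψ k) + ψ k * (1L - X) * W k ≈⟨ solve 4 (λ e w s p → e :* (w :* s) :+ p :* e :* w
                                                                           := e :* w :* (s :+ p)) refl (1L - X) (W k) (partialSum ψ k) (ψ k) ⟩
      (1L - X) * W k * (partialSum ψ k + ψ k)                 ∎

module SumAtPowersOfC
  (m : ℕ) (a : Fin m → ℕ) (a-injective : Injective _≡_ _≡_ a) (a≥1 : ∀ i → 1 ≤ a i)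
  (N : Vec Laurent m) (N-rational : ∀ i → IsRatC (lookup N i))
  (L : Laurent)
  (limit : IsLimAtInfinity (0L ∷ toList N) (prodFin m (λ i → 1L ∷ negL (powL C (a i)) ∷ [])) (negL L))
  (T : ℕ → Laurent)
  (T-def : ∀ n → T n *L evalZ (prodFin m (λ i → 1L ∷ negL (powL C (a i)) ∷ [])) (powL C n) ≈ evalZ (0L ∷ toList N) (powL C n))
  (ψ : ℕ → Laurent)
  (ψ-def : ∀ n → ψ n *L (1L -L powL C (suc n)) ≈ powL C (suc n))
  where

  open Valuation
  open Summation
  open PolynomialsInC
  open PolynomialsInZ
  open GeometricTerms ψ ψ-def
  open LaurentSeries using (+-*-commutativeRing; powL-+; +-congˡ; +-congʳ; *-congˡ; *-congʳ)
  open CommutativeRing +-*-commutativeRing hiding (_≈_; zero; +-congˡ; +-congʳ; *-congˡ; *-congʳ)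
  open import Algebra.Properties.CommutativeMonoid.Sum *-commutativeMonoid using () renaming (sum to product)
  open import Algebra.Properties.Semiring.Sum semiring using (sum; sum-cong-≋; *-distribˡ-sum)
  open IntegerCoefficientSolver +-*-commutativeRing
  open PartialFractions +-*-commutativeRing
  open Decomposition IsPolyC IsPolyC-0 IsPolyC-1 IsPolyC-+ IsPolyC-* IsPolyC-neg
                     IsNonzeroPolyC IsNonzeroPolyC-1 IsNonzeroPolyC-* IsNonzeroPolyC-resp
  open import Relation.Binary.Reasoning.Setoid setoid

  A : Fin m → Laurent
  A i = powL C (a i)

  k : Fin m → ℕ
  k i = a i ℕ.∸ 1

  a≡1+k : ∀ i → a i ≡ suc (k i)
  a≡1+k i = ≡.trans (≡.sym (ℕ.m∸n+n≡m (a≥1 i))) (ℕ.+-comm (k i) 1)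

  numeratorOf denominatorOf : Fin m → List ℚ
  numeratorOf   i = proj₁ (N-rational i)
  denominatorOf i = proj₁ (proj₂ (N-rational i))

  d : Fin m → Laurent
  d i = evalC (denominatorOf i)

  εN : Laurent
  εN = product d

  εN-nonzero : IsNonzeroPolyC εN
  εN-nonzero = IsNonzeroPolyC-product d (λ i → IsNonzeroPolyC-evalC (denominatorOf i) (proj₁ (proj₂ (proj₂ (N-rational i)))))

  εN*N-poly : ∀ i → IsPolyC (εN * lookup N i)
  εN*N-poly = IsPolyC-commonDenominator d (lookup N) (λ i → denominatorOf i , refl)
    (λ i → numeratorOf i , trans (*-comm (d i) (lookup N i)) (proj₂ (proj₂ (proj₂ (N-rational i)))))

  P : Vec Laurent (suc m)
  P = map (εN *_) (0L ∷ N)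

  P-poly : All IsPolyC P
  P-poly = IsPolyC-resp (sym (zeroʳ εN)) IsPolyC-0 ∷ All.map⁺ (All.lookup⁻ εN*N-poly)

  separated : Separated A
  separated = record
    { A∈S = λ i → IsPolyC-powL (a i) ; A∈M = λ i → IsNonzeroPolyC-powL (a i)
    ; A-A∈M = λ i≢j → C^-C^-nonzero (λ ai≡aj → i≢j (a-injective ai≡aj)) }

  expansion : PartialFractionExpansion A P
  expansion = expand A separated P P-poly

  open PartialFractionExpansion expansion

  ε : Laurent
  ε = δ * εN

  ε-nonzero : IsNonzeroPolyC ε
  ε-nonzero = IsNonzeroPolyC-* δ∈M εN-nonzero

  c₀+Σc≈0 : c₀ + sum c ≈ 0L
  c₀+Σc≈0 = begin
    c₀ + sum c         ≈⟨ expansion-at-0 expansion ⟨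
    δ * eval P 0L      ≈⟨ *-congˡ δ (solve 2 (λ e x → e :* con (+ 0) :+ con (+ 0) :* x := con (+ 0)) refl εN (eval (map (εN *_) N) 0L)) ⟩
    δ * 0L             ≈⟨ zeroʳ δ ⟩
    0L                 ∎

  leadingCoefficient : - L * product (λ i → - A i) ≈ last (0L ∷ N)
  leadingCoefficient = atDegree limit
    where
    atDegree : IsLimAtInfinity (0L ∷ toList N) (prodFin m (linearFactor ∘ A)) (- L) → - L * product (λ i → - A i) ≈ last (0L ∷ N)
    atDegree (deg , _ , D-vanishes , D-top≉0 , L-top) with ℕ.<-cmp deg m
    ... | tri< deg<m _ _ = ⊥-elim (product-negC^-nonzero a (trans (sym (proj₂ (prodFin-degree m A))) (D-vanishes m deg<m)))
    ... | tri> _ _ m<deg = ⊥-elim (D-top≉0 (proj₁ (prodFin-degree m A) deg m<deg))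
    ... | tri≈ _ ≡.refl _ = trans (*-congˡ (- L) (sym (proj₂ (prodFin-degree m A)))) (trans L-top (reflexive (coeffZ-toList (0L ∷ N))))

  c₀≈-εL : c₀ ≈ - (ε * L)
  c₀≈-εL = begin
    c₀                         ≈⟨ solve 2 (λ c x → c := (c :+ x) :- x) refl c₀ (ε * L) ⟩
    (c₀ + ε * L) - ε * L       ≈⟨ +-congʳ (- (ε * L)) (product-negC^-cancelˡ a (c₀ + ε * L) Π*[c₀+εL]≈0) ⟩
    0L - ε * L                 ≈⟨ +-identityˡ (- (ε * L)) ⟩
    - (ε * L)                  ∎
    where
    Π = product (λ i → - A i)
    Π*[c₀+εL]≈0 : Π * (c₀ + ε * L) ≈ 0L
    Π*[c₀+εL]≈0 = begin
      Π * (c₀ + δ * εN * L)                         ≈⟨ solve 5 (λ p c d e l → p :* (c :+ d :* e :* l) := c :* p :+ d :* e :* l :* p) refl Π c₀ δ εN L ⟩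
      c₀ * Π + δ * εN * L * Π                       ≈⟨ +-congʳ (δ * εN * L * Π) leading ⟩
      δ * last P + δ * εN * L * Π                   ≈⟨ +-congʳ (δ * εN * L * Π) (*-congˡ δ (reflexive (last-scale εN (0L ∷ N)))) ⟩
      δ * (εN * last (0L ∷ N)) + δ * εN * L * Π     ≈⟨ +-congʳ (δ * εN * L * Π) (*-congˡ δ (*-congˡ εN (sym leadingCoefficient))) ⟩
      δ * (εN * (- L * Π)) + δ * εN * L * Π         ≈⟨ solve 4 (λ d e l p → d :* (e :* (:- l :* p)) :+ d :* e :* l :* p := con (+ 0)) refl δ εN L Π ⟩
      0L                                            ∎

  Σc≈εL : sum c ≈ ε * L
  Σc≈εL = begin
    sum c                    ≈⟨ solve 2 (λ s c → s := (c :+ s) :- c) refl (sum c) c₀ ⟩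
    (c₀ + sum c) - c₀        ≈⟨ +-cong c₀+Σc≈0 (-‿cong c₀≈-εL) ⟩
    0L - - (ε * L)           ≈⟨ solve 1 (λ x → con (+ 0) :- (:- x) := x) refl (ε * L) ⟩
    ε * L                    ∎

  g : ℕ → Fin m → Laurent
  g n i = 1L + ψ (n ℕ.+ k i)

  g-inverse : ∀ n i → g n i * (1L - powL C n * A i) ≈ 1L
  g-inverse n i = trans (*-congˡ (g n i) (+-congˡ 1L (-‿cong CⁿA≈C^[1+n+k]))) (1+ψ-inverse (n ℕ.+ k i))
    where
    CⁿA≈C^[1+n+k] : powL C n * A i ≈ powL C (suc (n ℕ.+ k i))
    CⁿA≈C^[1+n+k] = trans (sym (powL-+ C n (a i)))
                          (reflexive (≡.cong (powL C) (≡.trans (≡.cong (n ℕ.+_) (a≡1+k i)) (ℕ.+-suc n (k i)))))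

  T-denominator : ∀ n → T n * denominator A (powL C n) ≈ eval (0L ∷ N) (powL C n)
  T-denominator n = trans (*-congˡ (T n) (sym (evalZ-prodFin m A (powL C n))))
                          (trans (T-def n) (reflexive (evalZ-toList (0L ∷ N) (powL C n))))

  εT≈ : ∀ n → ε * T n ≈ sum (λ i → c i * ψ (n ℕ.+ k i))
  εT≈ n = begin
    δ * εN * T n                                ≈⟨ *-assoc δ εN (T n) ⟩
    δ * (εN * T n)                              ≈⟨ expansion-at-units expansion {powL C n} {εN * T n} (g n) (g-inverse n) εNT-denominator ⟩
    c₀ + sum (λ i → c i * g n i)                ≈⟨ +-congˡ c₀ (sum-*-add c (λ i → ψ (n ℕ.+ k i)) 1L) ⟩
    c₀ + (sum c * 1L + t)                       ≈⟨ solve 3 (λ c s t → c :+ (s :* con (+ 1) :+ t) := (c :+ s) :+ t) refl c₀ (sum c) t ⟩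
    (c₀ + sum c) + t                            ≈⟨ +-congʳ t c₀+Σc≈0 ⟩
    0L + t                                      ≈⟨ +-identityˡ t ⟩
    t                                           ∎
    where
    t = sum (λ i → c i * ψ (n ℕ.+ k i))
    z = powL C n
    εNT-denominator : εN * T n * denominator A z ≈ eval P z
    εNT-denominator = trans (*-assoc εN (T n) (denominator A z))
                            (trans (*-congˡ εN (T-denominator n)) (sym (eval-scale εN (0L ∷ N) z)))

  K : ℕ
  K = orderBound N

  T-order : ∀ n → OrderAtLeast (T n) (+ n ℤ.- + K)
  T-order n = OrderAtLeast-resp (sym T≈VG)
    (OrderAtLeast-mono (ℤ.≤-reflexive (≡.sym (ℤ.+-identityʳ (+ n ℤ.- + K))))
      (OrderAtLeast-* {V} {G} V-order (OrderAtLeast-product (g n) (λ i → OrderAtLeast-1+ψ (n ℕ.+ k i)))))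
    where
    z = powL C n
    V = eval (0L ∷ N) z
    G = product (g n)
    T≈VG : T n ≈ V * G
    T≈VG = begin
      T n                            ≈⟨ *-identityʳ (T n) ⟨
      T n * 1L                       ≈⟨ *-congˡ (T n) (denominator*inverses A z (g n) (g-inverse n)) ⟨
      T n * (denominator A z * G)    ≈⟨ *-assoc (T n) (denominator A z) G ⟨
      T n * denominator A z * G      ≈⟨ *-congʳ G (T-denominator n) ⟩
      V * G                          ∎
    V-order : OrderAtLeast V (+ n ℤ.- + K)
    V-order = OrderAtLeast-+ {0L} {z * eval N z} (OrderAtLeast-0 _)
      (OrderAtLeast-* {z} {eval N z} (OrderAtLeast-C^ n) (OrderAtLeast-eval N z (OrderAtLeast-mono (+≤+ z≤n) (OrderAtLeast-C^ n))))

  T-summable : Σ Laurent (IsSum T)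
  T-summable = IsSum-exists T K T-order

  ψ-summable : Σ Laurent (IsSum ψ)
  ψ-summable = IsSum-exists ψ 0 (λ n → OrderAtLeast-mono (+≤+ (ℕ.≤-trans (ℕ.≤-reflexive (ℕ.+-identityʳ n)) (ℕ.n≤1+n n))) (ψ-order n))

  S Ψ Q : Laurent
  S = proj₁ T-summable
  Ψ = proj₁ ψ-summable
  Q = S - L * Ψ

  S≈Q+LΨ : S ≈ Q + L * Ψ
  S≈Q+LΨ = solve 3 (λ s l p → s := (s :- l :* p) :+ l :* p) refl S L Ψ

  εS≈ : ε * S ≈ sum (λ i → c i * (Ψ - partialSum ψ (k i)))
  εS≈ = IsSum-unique (IsSum-scale ε (proj₂ T-summable))
    (IsSum-cong (λ n → sym (εT≈ n)) refl
      (IsSum-sum (λ i n → c i * ψ (n ℕ.+ k i)) (λ i → c i * (Ψ - partialSum ψ (k i)))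
                 (λ i → IsSum-scale (c i) (IsSum-drop (k i) (proj₂ ψ-summable)))))

  εQ≈ : ε * Q ≈ - sum (λ i → c i * partialSum ψ (k i))
  εQ≈ = begin
    ε * (S - L * Ψ)                                     ≈⟨ solve 4 (λ e s l p → e :* (s :- l :* p) := e :* s :- e :* l :* p) refl ε S L Ψ ⟩
    ε * S - ε * L * Ψ                                   ≈⟨ +-cong εS≈ (-‿cong (*-congʳ Ψ (sym Σc≈εL))) ⟩
    sum (λ i → c i * (Ψ - ps i)) - sum c * Ψ            ≈⟨ +-congʳ (- (sum c * Ψ)) (sum-*-sub c ps Ψ) ⟩
    (sum c * Ψ - sum (λ i → c i * ps i)) - sum c * Ψ    ≈⟨ solve 2 (λ x y → (x :- y) :- x := :- y) refl (sum c * Ψ) (sum (λ i → c i * ps i)) ⟩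
    - sum (λ i → c i * ps i)                            ∎
    where ps = λ i → partialSum ψ (k i)

  -- Multiplying by ε and by the W (k i) clears all denominators of Q.
  Q-rational : IsRatC Q
  Q-rational = IsRatC-intro {Wₖ * ε} {Q} (IsNonzeroPolyC-* (IsNonzeroPolyC-product (W ∘ k) (W-nonzero ∘ k)) ε-nonzero)
    (IsPolyC-resp WεQ≈ (IsPolyC-neg (IsPolyC-sum _ (λ i → IsPolyC-* (c∈S i) (Wₖ*ps-poly i)))))
    where
    Wₖ = product (W ∘ k)
    ps = λ i → partialSum ψ (k i)
    Wₖ*ps-poly : ∀ i → IsPolyC (Wₖ * ps i)
    Wₖ*ps-poly = IsPolyC-commonDenominator (W ∘ k) ps (W-poly ∘ k) (W*partialSum-poly ∘ k)
    WεQ≈ : - sum (λ i → c i * (Wₖ * ps i)) ≈ Wₖ * ε * Q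
    WεQ≈ = begin
      - sum (λ i → c i * (Wₖ * ps i))    ≈⟨ -‿cong (sum-cong-≋ (λ i → solve 3 (λ c w p → c :* (w :* p) := w :* (c :* p)) refl (c i) Wₖ (ps i))) ⟩
      - sum (λ i → Wₖ * (c i * ps i))    ≈⟨ -‿cong (*-distribˡ-sum Wₖ (λ i → c i * ps i)) ⟨
      - (Wₖ * sum (λ i → c i * ps i))    ≈⟨ solve 2 (λ w s → :- (w :* s) := w :* (:- s)) refl Wₖ (sum (λ i → c i * ps i)) ⟩
      Wₖ * - sum (λ i → c i * ps i)      ≈⟨ *-congˡ Wₖ εQ≈ ⟨
      Wₖ * (ε * Q)                       ≈⟨ *-assoc Wₖ ε Q ⟨
      Wₖ * ε * Q                         ∎

lemma3p3 : (m : ℕ) (a : Fin m → ℕ) → Injective _≡_ _≡_ a → (∀ i → 1 ≤ a i)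
    → (N : Vec Laurent m) → (∀ i → IsRatC (lookup N i))
    → (L : Laurent)
    → IsLimAtInfinity (0L ∷ toList N) (prodFin m (λ i → 1L ∷ negL (powL C (a i)) ∷ [])) (negL L)
    → (T : ℕ → Laurent)
    → (∀ n → T n *L evalZ (prodFin m (λ i → 1L ∷ negL (powL C (a i)) ∷ [])) (powL C n)
               ≈ evalZ (0L ∷ toList N) (powL C n))
    → (ψ : ℕ → Laurent)
    → (∀ n → ψ n *L (1L -L powL C (suc n)) ≈ powL C (suc n))
    → Σ Laurent λ S → Σ Laurent λ Ψ₁ → IsSum T S × IsSum ψ Ψ₁
        × Σ Laurent λ Q → IsRatC Q × (S ≈ Q +L L *L Ψ₁)
lemma3p3 m a a-injective a≥1 N N-rational L limit T T-def ψ ψ-def =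
  S , Ψ , proj₂ T-summable , proj₂ ψ-summable , Q , Q-rational , S≈Q+LΨ
  where open SumAtPowersOfC m a a-injective a≥1 N N-rational L limit T T-def ψ ψ-def
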